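{- Let $A$ be a prime with $A\equiv 7\pmod 8$. Then there exist positive integers $a,b$ with $A=a^2-2b^2$ and nonnegative integers $l,m$ satisfying $$2alm-b(l^2+2m^2)=\pm 1$$ (for one of the two signs) such that the minimal natural solution $x$ of Pell's equation $y^2-Ax^2=1$ is $$x=\bigl|\,\bigl(a(l^2+2m^2)-4blm\bigr)(l^2-2m^2)\,\bigr|.$$
   Context: For a positive integer $A$ that is not a perfect square, the minimal natural solution of Pell's equation $y^2-Ax^2=1$ is the smallest positive integer $x$ for which there is a positive integer $y$ with $y^2-Ax^2=1$ (the trivial solution $(x,y)=(0,1)$ is excluded). -}

module Defs where

open import Data.Nat using (ℕ; _+_; _*_; _≤_; _<_)
open import Data.Product using (Σ; _×_)
open import Relation.Binary.PropositionalEquality using (_≡_)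

PellSolution : ℕ → ℕ → Set
PellSolution A x = 0 < x × Σ ℕ (λ y → 0 < y × y * y ≡ A * (x * x) + 1)

MinimalPellSolution : ℕ → ℕ → Set
MinimalPellSolution A x = PellSolution A x × (∀ x′ → PellSolution A x′ → x ≤ x′)

-- Dirichlet's approximation theorem yields infinitely many p, q with |p² - Aq²| ≤ 2(⌊√A⌋ + 1); two of them
-- with the same norm k and congruent modulo k compose to a solution of Pell's equation, so a minimal one
-- (x, y) exists. Factoring (y - 1)(y + 1) = Ax² into coprime parts, minimality and squares modulo 8 leave
-- only x = ud with u² - Ad² = 2. The form dk² - 2ukj + Adj² has discriminant 8, so by reduction it
-- represents ±1, and in ℤ[√2] such a representation gives α = a + b√2 of norm A and γ = l + m√2 with
-- α γ̄² = u + √2 and γ γ̄ = ±d, which is the stated formula for x. The symmetries α ↦ -α, simultaneous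
-- conjugation and (α, γ) ↦ ((1 + √2)² α, (1 + √2) γ) then make a, b > 0 and l, m ≥ 0.

module Submission where

module Squares where

  open import Data.Nat.Base
  open import Data.Nat.Properties
  open import Data.Product.Base using (Σ; ∃; _×_; _,_; proj₁; proj₂)
  open import Relation.Binary.PropositionalEquality
  open import Relation.Nullary.Decidable using (Dec; yes; no)
  open import Relation.Nullary.Negation using (contradiction)

  m*m<n*n⇒m<n : ∀ {m n} → m * m < n * n → m < n
  m*m<n*n⇒m<n {m} {n} mm<nn with m <? n
  ... | yes m<n = m<n
  ... | no m≮n = let n≤m = ≮⇒≥ m≮n in contradiction (*-mono-≤ n≤m n≤m) (<⇒≱ mm<nn)

  m*m≤n*n⇒m≤n : ∀ {m n} → m * m ≤ n * n → m ≤ n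
  m*m≤n*n⇒m≤n {m} {n} mm≤nn with n <? m
  ... | yes n<m = contradiction (*-mono-< n<m n<m) (≤⇒≯ mm≤nn)
  ... | no n≮m = ≮⇒≥ n≮m

  m*m≡n*n⇒m≡n : ∀ {m n} → m * m ≡ n * n → m ≡ n
  m*m≡n*n⇒m≡n eq = ≤-antisym (m*m≤n*n⇒m≤n (≤-reflexive eq)) (m*m≤n*n⇒m≤n (≤-reflexive (sym eq)))

  private
    isqrt-spec : ∀ n → Σ ℕ λ r → r * r ≤ n × n < suc r * suc r
    isqrt-spec zero = 0 , z≤n , s≤s z≤n
    isqrt-spec (suc n) with isqrt-spec n
    ... | r , lower , upper with suc r * suc r ≤? suc n
    ...   | yes r+1-fits = suc r , r+1-fits , <-≤-trans (s≤s upper) (*-mono-< (n<1+n (suc r)) (n<1+n (suc r)))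
    ...   | no r+1-too-big = r , m≤n⇒m≤1+n lower , ≰⇒> r+1-too-big

  opaque
    isqrt : ℕ → ℕ
    isqrt n = proj₁ (isqrt-spec n)

    isqrt-lower : ∀ n → isqrt n * isqrt n ≤ n
    isqrt-lower n = proj₁ (proj₂ (isqrt-spec n))

    isqrt-upper : ∀ n → n < suc (isqrt n) * suc (isqrt n)
    isqrt-upper n = proj₂ (proj₂ (isqrt-spec n))

  isqrt-greatest : ∀ {m n} → m * m ≤ n → m ≤ isqrt n
  isqrt-greatest {m} {n} mm≤n = ≤-pred (m*m<n*n⇒m<n (≤-<-trans mm≤n (isqrt-upper n)))

  square? : ∀ n → Dec (∃ λ r → r * r ≡ n)
  square? n with isqrt n * isqrt n ≟ n
  ... | yes r²≡n = yes (isqrt n , r²≡n)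
  ... | no r²≢n = no λ (r , r²≡n) → r²≢n (subst (λ s → s * s ≡ n) (r≡isqrt {r} r²≡n) r²≡n)
    where
    r≡isqrt : ∀ {r} → r * r ≡ n → r ≡ isqrt n
    r≡isqrt r²≡n = ≤-antisym (isqrt-greatest (≤-reflexive r²≡n))
                            (m*m≤n*n⇒m≤n (subst (isqrt n * isqrt n ≤_) (sym r²≡n) (isqrt-lower n)))

  m*m≡n+1⇒0<m : ∀ {m n} → m * m ≡ n + 1 → 0 < m
  m*m≡n+1⇒0<m {zero} {n} eq = contradiction (trans eq (+-comm n 1)) λ ()
  m*m≡n+1⇒0<m {suc m} _ = s≤s z≤n

module PrimeSquares where

  open import Data.Nat.Base
  open import Data.Nat.Properties
  open import Data.Nat.Divisibility
  open import Data.Nat.DivMod using (_%_; _/_; m≡m%n+[m/n]*n; m%n<n; [m+kn]%n≡m%n; m*n%n≡0)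
  open import Data.Nat.GCD using (gcd; gcd[m,n]∣m; gcd[m,n]∣n; gcd-greatest; c*gcd[m,n]≡gcd[cm,cn]; gcd[m,n]≡0⇒m≡0)
  open import Data.Nat.Coprimality using (Coprime; coprime-divisor; coprime-+; 1-coprimeTo) renaming (sym to coprime-sym)
  open import Data.Nat.Induction using (<-rec)
  open import Data.Nat.Primality using (Prime; euclidsLemma; prime⇒nonZero; prime⇒nonTrivial; prime⇒irreducible; prime[2])
  open import Data.Nat.Tactic.RingSolver using (solve-∀)
  open import Data.Product.Base using (∃; ∃₂; _×_; _,_; proj₁; proj₂)
  open import Data.Sum.Base using (_⊎_; inj₁; inj₂)
  open import Relation.Binary.PropositionalEquality
  open ≡-Reasoning
  open import Relation.Nullary.Decidable using (yes; no; ¬?; toWitness)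
  open import Relation.Nullary.Negation using (¬_; contradiction)

  open Squares

  prime∣m*m⇒prime∣m : ∀ {p m} → Prime p → p ∣ m * m → p ∣ m
  prime∣m*m⇒prime∣m {m = m} p-prime p∣m*m with euclidsLemma m m p-prime p∣m*m
  ... | inj₁ p∣m = p∣m
  ... | inj₂ p∣m = p∣m

  private
    [m*A]²≡A*[A*m²] : ∀ m A → m * A * (m * A) ≡ A * (A * (m * m))
    [m*A]²≡A*[A*m²] = solve-∀

    [m*n]²≡m*m*n*n : ∀ m n → m * n * (m * n) ≡ m * m * n * n
    [m*n]²≡m*m*n*n = solve-∀

    [m*m]*[n*n]≡[m*n]² : ∀ m n → m * m * (n * n) ≡ m * n * (m * n)
    [m*m]*[n*n]≡[m*n]² = solve-∀

  p*p≡A*[q*q]⇒q≡0 : ∀ {A} → Prime A → ∀ p q → p * p ≡ A * (q * q) → q ≡ 0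
  p*p≡A*[q*q]⇒q≡0 {A} A-prime p q = <-rec (λ q → ∀ p → p * p ≡ A * (q * q) → q ≡ 0) descent q p
    where
    instance _ = prime⇒nonZero A-prime
    descent : ∀ q → (∀ {q′} → q′ < q → ∀ p → p * p ≡ A * (q′ * q′) → q′ ≡ 0) →
              ∀ p → p * p ≡ A * (q * q) → q ≡ 0
    descent q rec p eq = trans q≡q′*A (cong (_* A) (q′≡0 q′ q≡q′*A p′*p′≡A*[q′*q′]))
      where
      A∣p : A ∣ p
      A∣p = prime∣m*m⇒prime∣m A-prime (divides (q * q) (trans eq (*-comm A (q * q))))
      p′ = quotient A∣p
      q*q≡A*[p′*p′] : q * q ≡ A * (p′ * p′)
      q*q≡A*[p′*p′] = *-cancelˡ-≡ (q * q) (A * (p′ * p′)) A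
        (trans (sym eq) (trans (cong (λ m → m * m) (m∣n⇒n≡quotient*m A∣p)) ([m*A]²≡A*[A*m²] p′ A)))
      A∣q : A ∣ q
      A∣q = prime∣m*m⇒prime∣m A-prime (divides (p′ * p′) (trans q*q≡A*[p′*p′] (*-comm A (p′ * p′))))
      q′ = quotient A∣q
      q≡q′*A : q ≡ q′ * A
      q≡q′*A = m∣n⇒n≡quotient*m A∣q
      p′*p′≡A*[q′*q′] : p′ * p′ ≡ A * (q′ * q′)
      p′*p′≡A*[q′*q′] = sym (*-cancelˡ-≡ (A * (q′ * q′)) (p′ * p′) A
        (trans (sym ([m*A]²≡A*[A*m²] q′ A)) (trans (cong (λ m → m * m) (sym q≡q′*A)) q*q≡A*[p′*p′])))
      q′≡0 : ∀ q′ → q ≡ q′ * A → p′ * p′ ≡ A * (q′ * q′) → q′ ≡ 0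
      q′≡0 zero _ _ = refl
      q′≡0 q′@(suc _) q≡q′*A = rec (subst (q′ <_) (sym q≡q′*A)
          (m<m*n q′ A (nonTrivial⇒n>1 A {{prime⇒nonTrivial A-prime}}))) p′

  coprime-product-square : ∀ {a b c} → Coprime a b → a * b ≡ c * c → ∃ λ r → a ≡ r * r
  coprime-product-square {a} {b} {c} coprime ab≡cc = g , ∣-antisym a∣g*g g*g∣a
    where
    g = gcd a c
    a∣c*c : a ∣ c * c
    a∣c*c = divides b (trans (sym ab≡cc) (*-comm a b))
    a∣m*g : ∀ m → a ∣ m * c → a ∣ m * g
    a∣m*g m a∣mc = subst (a ∣_) (sym (c*gcd[m,n]≡gcd[cm,cn] m a c)) (gcd-greatest (n∣m*n m) a∣mc)
    a∣g*g : a ∣ g * g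
    a∣g*g = a∣m*g g (subst (a ∣_) (*-comm c g) (a∣m*g c a∣c*c))
    g*g∣a : g * g ∣ a
    g*g∣a with g ≟ 0
    ... | yes g≡0 = subst (g * g ∣_) (sym (gcd[m,n]≡0⇒m≡0 g≡0)) ((g * g) ∣0)
    ... | no g≢0 = subst (g * g ∣_) (sym a≡a′*g) (*-monoˡ-∣ g g∣a′)
      where
      instance _ = ≢-nonZero g≢0
      a′ = quotient (gcd[m,n]∣m a c)
      c′ = quotient (gcd[m,n]∣n a c)
      a≡a′*g : a ≡ a′ * g
      a≡a′*g = m∣n⇒n≡quotient*m (gcd[m,n]∣m a c)
      c≡c′*g : c ≡ c′ * g
      c≡c′*g = m∣n⇒n≡quotient*m (gcd[m,n]∣n a c)
      b*a′≡c′*c′*g : b * a′ ≡ c′ * c′ * g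
      b*a′≡c′*c′*g = *-cancelʳ-≡ (b * a′) (c′ * c′ * g) g (begin
        b * a′ * g        ≡⟨ *-assoc b a′ g ⟩
        b * (a′ * g)      ≡⟨ cong (b *_) (sym a≡a′*g) ⟩
        b * a             ≡⟨ *-comm b a ⟩
        a * b             ≡⟨ ab≡cc ⟩
        c * c             ≡⟨ cong (λ m → m * m) c≡c′*g ⟩
        c′ * g * (c′ * g) ≡⟨ [m*n]²≡m*m*n*n c′ g ⟩
        c′ * c′ * g * g   ∎)
      g∣a′ : g ∣ a′
      g∣a′ = coprime-divisor (λ (i∣g , i∣b) → coprime (∣-trans i∣g (gcd[m,n]∣m a c) , i∣b))
                             (divides (c′ * c′) b*a′≡c′*c′*g)

  private
    divisor-side : ∀ {A a b c} → Prime A → Coprime a b → a * b ≡ A * (c * c) → A ∣ a →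
                   ∃₂ λ s t → a ≡ A * (s * s) × b ≡ t * t × c ≡ s * t
    divisor-side {A} {a} {b} {c} A-prime coprime ab≡Acc (divides w a≡w*A) =
      from-squares (coprime-product-square {c = c} coprime-w-b w*b≡c*c)
                   (coprime-product-square {c = c} (coprime-sym coprime-w-b) (trans (*-comm b w) w*b≡c*c))
      where
      instance _ = prime⇒nonZero A-prime
      w*b≡c*c : w * b ≡ c * c
      w*b≡c*c = *-cancelˡ-≡ (w * b) (c * c) A (begin
        A * (w * b)  ≡⟨ *-assoc A w b ⟨
        A * w * b    ≡⟨ cong (_* b) (*-comm A w) ⟩
        w * A * b    ≡⟨ cong (_* b) a≡w*A ⟨
        a * b        ≡⟨ ab≡Acc ⟩
        A * (c * c)  ∎)
      coprime-w-b : Coprime w b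
      coprime-w-b (i∣w , i∣b) = coprime (∣-trans i∣w (divides A (trans a≡w*A (*-comm w A))) , i∣b)
      from-squares : (∃ λ s → w ≡ s * s) → (∃ λ t → b ≡ t * t) →
          ∃₂ λ s t → a ≡ A * (s * s) × b ≡ t * t × c ≡ s * t
      from-squares (s , w≡s*s) (t , b≡t*t) = s , t , trans a≡w*A (trans (cong (_* A) w≡s*s) (*-comm (s * s) A)) , b≡t*t ,
        m*m≡n*n⇒m≡n (begin
          c * c           ≡⟨ w*b≡c*c ⟨
          w * b           ≡⟨ cong₂ _*_ w≡s*s b≡t*t ⟩
          s * s * (t * t) ≡⟨ [m*m]*[n*n]≡[m*n]² s t ⟩
          s * t * (s * t) ∎)

  coprime-product-prime-square : ∀ {A a b c} → Prime A → Coprime a b → a * b ≡ A * (c * c) →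
    (∃₂ λ s t → a ≡ A * (s * s) × b ≡ t * t × c ≡ s * t) ⊎
    (∃₂ λ s t → a ≡ s * s × b ≡ A * (t * t) × c ≡ s * t)
  coprime-product-prime-square {A} {a} {b} {c} A-prime coprime ab≡Acc
    with euclidsLemma a b A-prime (divides (c * c) (trans ab≡Acc (*-comm A (c * c))))
  ... | inj₁ A∣a = inj₁ (divisor-side A-prime coprime ab≡Acc A∣a)
  ... | inj₂ A∣b = inj₂ (swap (divisor-side A-prime (coprime-sym coprime) (trans (*-comm b a) ab≡Acc) A∣b))
    where
    swap : (∃₂ λ s t → b ≡ A * (s * s) × a ≡ t * t × c ≡ s * t) → ∃₂ λ s t → a ≡ s * s × b ≡ A * (t * t) × c ≡ s * t
    swap (s , t , b≡A*s² , a≡t² , c≡s*t) = t , s , a≡t² , b≡A*s² , trans c≡s*t (*-comm s t)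

  consecutive-coprime : ∀ n → Coprime n (n + 1)
  consecutive-coprime n = coprime-sym (coprime-+ (1-coprimeTo n))

  2∤1+k*2 : ∀ k → ¬ 2 ∣ 1 + k * 2
  2∤1+k*2 k 2∣1+k*2 = 1+n≢0 (trans (sym ([m+kn]%n≡m%n 1 k 2)) (n∣m⇒m%n≡0 (1 + k * 2) 2 2∣1+k*2))

  consecutive-odd-coprime : ∀ k → Coprime (1 + k * 2) (3 + k * 2)
  consecutive-odd-coprime k {i} (i∣m , i∣m+2) with prime⇒irreducible prime[2]
      (∣m+n∣m⇒∣n (subst (i ∣_) (+-comm 2 (1 + k * 2)) i∣m+2) i∣m)
  ... | inj₁ i≡1 = i≡1
  ... | inj₂ refl = contradiction i∣m (2∤1+k*2 k)

  private
    square-residues : ∀ c → c ≡ 1 ⊎ c ≡ 2 → ∀ {r} → r < 8 → ∀ {r′} → r′ < 8 → (r * r + r′ * r′ + c) % 8 ≢ 0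
    square-residues c (inj₁ refl) = toWitness {a? = allUpTo? (λ r → allUpTo? (λ r′ → ¬? ((r * r + r′ * r′ + 1) % 8 ≟ 0)) 8) 8} _
    square-residues c (inj₂ refl) = toWitness {a? = allUpTo? (λ r → allUpTo? (λ r′ → ¬? ((r * r + r′ * r′ + 2) % 8 ≟ 0)) 8) 8} _

    reduce-mod-8 : ∀ r k r′ k′ c → (r + k * 8) * (r + k * 8) + (r′ + k′ * 8) * (r′ + k′ * 8) + c
                                  ≡ r * r + r′ * r′ + c + (k * (2 * r + k * 8) + k′ * (2 * r′ + k′ * 8)) * 8
    reduce-mod-8 = solve-∀

    regroup : ∀ t s c → t * t + s * s + c ≡ (t * t + c) + s * s
    regroup = solve-∀

    [7+q*8]*S+S≡[1+q]*S*8 : ∀ q S → (7 + q * 8) * S + S ≡ (1 + q) * S * 8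
    [7+q*8]*S+S≡[1+q]*S*8 = solve-∀

  -- Squares are 0, 1 or 4 modulo 8 and A s² ≡ -s², so t² + c ≡ A s² would force t² + s² + c ≡ 0.
  mod-8-obstruction : ∀ {A c} t s → A % 8 ≡ 7 → c ≡ 1 ⊎ c ≡ 2 → t * t + c ≢ A * (s * s)
  mod-8-obstruction {A} {c} t s A%8≡7 c≡1∨c≡2 eq = square-residues c c≡1∨c≡2 (m%n<n t 8) (m%n<n s 8) (begin
    (r * r + r′ * r′ + c) % 8                 ≡⟨ sym ([m+kn]%n≡m%n (r * r + r′ * r′ + c) k″ 8) ⟩
    (r * r + r′ * r′ + c + k″ * 8) % 8        ≡⟨ cong (_% 8) (sym (reduce-mod-8 r k r′ k′ c)) ⟩
    ((r + k * 8) * (r + k * 8) + (r′ + k′ * 8) * (r′ + k′ * 8) + c) % 8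
      ≡⟨ cong₂ (λ t s → (t * t + s * s + c) % 8) (sym (m≡m%n+[m/n]*n t 8)) (sym (m≡m%n+[m/n]*n s 8)) ⟩
    (t * t + s * s + c) % 8                   ≡⟨ cong (_% 8) (regroup t s c) ⟩
    (t * t + c + s * s) % 8                   ≡⟨ cong (λ n → (n + s * s) % 8) eq ⟩
    (A * (s * s) + s * s) % 8                 ≡⟨ cong (λ A → (A * (s * s) + s * s) % 8) A≡7+q*8 ⟩
    ((7 + q * 8) * (s * s) + s * s) % 8       ≡⟨ cong (_% 8) ([7+q*8]*S+S≡[1+q]*S*8 q (s * s)) ⟩
    ((1 + q) * (s * s) * 8) % 8               ≡⟨ m*n%n≡0 ((1 + q) * (s * s)) 8 ⟩
    0                                         ∎)
    where
    r = t % 8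
    k = t / 8
    r′ = s % 8
    k′ = s / 8
    k″ = k * (2 * r + k * 8) + k′ * (2 * r′ + k′ * 8)
    q = A / 8
    A≡7+q*8 : A ≡ 7 + q * 8
    A≡7+q*8 = trans (m≡m%n+[m/n]*n A 8) (cong (_+ q * 8) A%8≡7)

module Dirichlet where

  open import Data.Nat.Base
  open import Data.Nat.Properties
  open import Data.Nat.Tactic.RingSolver using (solve-∀)
  open import Data.Fin.Base using (Fin; toℕ; fromℕ<)
  open import Data.Fin.Properties using (pigeonhole; toℕ-fromℕ<; toℕ<n)
  open import Data.Product.Base using (∃₂; _×_; _,_; proj₁; proj₂)
  open import Relation.Binary.PropositionalEquality

  open Squares

  ⌊_√_⌋ : ℕ → ℕ → ℕ
  ⌊ q √ C ⌋ = isqrt (C * (q * q))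

  Close : ℕ → ℕ → ℕ → ℕ → Set
  Close A N p q = 1 ≤ q × q ≤ N × ⌊ q √ (N * N * A) ⌋ ≤ N * p × N * p ≤ suc ⌊ q √ (N * N * A) ⌋

  Approximation : ℕ → ℕ → ℕ → ℕ → Set
  Approximation A N p q = 1 ≤ q × p ≤ N * suc (isqrt A) ×
    N * (p * p) ≤ N * (A * (q * q)) + 2 * p × N * (A * (q * q)) ≤ N * (p * p) + 2 * p

  private
    [x+y]² : ∀ x y → (x + y) * (x + y) ≡ x * x + 2 * (x * y) + y * y
    [x+y]² = solve-∀
    C[a+b]² : ∀ C a b → C * ((a + b) * (a + b)) ≡ C * (a * a) + 2 * (C * a * b) + C * (b * b)
    C[a+b]² = solve-∀
    [xy]² : ∀ x y → x * y * (x * y) ≡ x * x * (y * y)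
    [xy]² = solve-∀
    [Cab]² : ∀ C a b → C * a * b * (C * a * b) ≡ C * (a * a) * (C * (b * b))
    [Cab]² = solve-∀
    N*N*[x*x] : ∀ N x → N * x * (N * x) ≡ N * N * (x * x)
    N*N*[x*x] = solve-∀
    reassoc : ∀ N A q → N * N * (A * (q * q)) ≡ N * N * A * (q * q)
    reassoc = solve-∀
    N*N*[1+x]² : ∀ N x → N * N * (suc x * suc x) ≡ (N * x + N) * (N * x + N)
    N*N*[1+x]² = solve-∀

  ≤√-+ : ∀ C x y a b → x * x ≤ C * (a * a) → y * y ≤ C * (b * b) → (x + y) * (x + y) ≤ C * ((a + b) * (a + b))
  ≤√-+ C x y a b x≤ y≤ = subst₂ _≤_ (sym ([x+y]² x y)) (sym (C[a+b]² C a b))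
    (+-mono-≤ (+-mono-≤ x≤ (*-monoʳ-≤ 2 xy≤Cab)) y≤)
    where
    xy≤Cab : x * y ≤ C * a * b
    xy≤Cab = m*m≤n*n⇒m≤n (subst₂ _≤_ (sym ([xy]² x y)) (sym ([Cab]² C a b)) (*-mono-≤ x≤ y≤))

  >√-+ : ∀ C x y a b → C * (a * a) < x * x → C * (b * b) < y * y → C * ((a + b) * (a + b)) < (x + y) * (x + y)
  >√-+ C x y a b x> y> = subst₂ _<_ (sym (C[a+b]² C a b)) (sym ([x+y]² x y))
    (+-mono-< (+-mono-≤-< (<⇒≤ x>) (*-monoʳ-< 2 Cab<xy)) y>)
    where
    Cab<xy : C * a * b < x * y
    Cab<xy = m*m<n*n⇒m<n (subst₂ _<_ (sym ([Cab]² C a b)) (sym ([xy]² x y)) (*-mono-< x> y>))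

  ⌊√⌋-superadditive : ∀ C a b → ⌊ a √ C ⌋ + ⌊ b √ C ⌋ ≤ ⌊ (a + b) √ C ⌋
  ⌊√⌋-superadditive C a b = isqrt-greatest (≤√-+ C ⌊ a √ C ⌋ ⌊ b √ C ⌋ a b
    (isqrt-lower (C * (a * a))) (isqrt-lower (C * (b * b))))

  ⌊√⌋-+-upper : ∀ C a b → ⌊ (a + b) √ C ⌋ < suc ⌊ a √ C ⌋ + suc ⌊ b √ C ⌋
  ⌊√⌋-+-upper C a b = m*m<n*n⇒m<n (≤-<-trans (isqrt-lower (C * ((a + b) * (a + b))))
    (>√-+ C (suc ⌊ a √ C ⌋) (suc ⌊ b √ C ⌋) a b (isqrt-upper (C * (a * a))) (isqrt-upper (C * (b * b)))))

  ⌊√⌋-monoˡ-≤ : ∀ C {a b} → a ≤ b → ⌊ a √ C ⌋ ≤ ⌊ b √ C ⌋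
  ⌊√⌋-monoˡ-≤ C a≤b = isqrt-greatest (≤-trans (isqrt-lower _) (*-monoʳ-≤ C (*-mono-≤ a≤b a≤b)))

  N*⌊√⌋≤⌊√N*N*⌋ : ∀ N A q → N * ⌊ q √ A ⌋ ≤ ⌊ q √ (N * N * A) ⌋
  N*⌊√⌋≤⌊√N*N*⌋ N A q = isqrt-greatest (subst₂ _≤_ (sym (N*N*[x*x] N _)) (reassoc N A q)
    (*-monoʳ-≤ (N * N) (isqrt-lower (A * (q * q)))))

  ⌊√N*N*⌋<N*⌊√⌋+N : ∀ N A q .{{_ : NonZero N}} → ⌊ q √ (N * N * A) ⌋ < N * ⌊ q √ A ⌋ + N
  ⌊√N*N*⌋<N*⌊√⌋+N N A q = m*m<n*n⇒m<n (≤-<-trans (isqrt-lower (N * N * A * (q * q)))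
    (subst₂ _<_ (reassoc N A q) (N*N*[1+x]² N _) (*-monoʳ-< (N * N) {{m*n≢0 N N}} (isqrt-upper (A * (q * q))))))

  module _ (A N : ℕ) .{{_ : NonZero N}} where
    private
      W R frac : ℕ → ℕ
      W q = ⌊ q √ (N * N * A) ⌋
      R q = ⌊ q √ A ⌋
      frac q = W q ∸ N * R q

      frac<N : ∀ q → frac q < N
      frac<N q = subst (frac q <_) (m+n∸m≡n (N * R q) N)
                   (∸-monoˡ-< (⌊√N*N*⌋<N*⌊√⌋+N N A q) (N*⌊√⌋≤⌊√N*N*⌋ N A q))

      W≡N*R+frac : ∀ q → W q ≡ N * R q + frac q
      W≡N*R+frac q = sym (m+[n∸m]≡n (N*⌊√⌋≤⌊√N*N*⌋ N A q))

      collision⇒approximation : ∀ {q₁ q₂} → q₁ < q₂ → q₂ ≤ N → frac q₁ ≡ frac q₂ →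
        ∃₂ (Close A N)
      collision⇒approximation {q₁} {q₂} q₁<q₂ q₂≤N frac≡ = p , q , m<n⇒0<n∸m q₁<q₂ , ≤-trans (m∸n≤m q₂ q₁) q₂≤N ,
        +-cancelʳ-≤ (W q₁) (W q) (N * p) (subst (W q + W q₁ ≤_) W₂≡ (⌊√⌋-superadditive (N * N * A) q q₁)) ,
        +-cancelʳ-≤ (W q₁) (N * p) (suc (W q))
          (≤-pred (subst₂ _<_ W₂≡ (cong suc (+-suc (W q) (W q₁))) (⌊√⌋-+-upper (N * N * A) q q₁)))
        where
        q = q₂ ∸ q₁
        q+q₁≡q₂ : q + q₁ ≡ q₂
        q+q₁≡q₂ = m∸n+n≡m (<⇒≤ q₁<q₂)
        p = R q₂ ∸ R q₁
        R₁+p≡R₂ : R q₁ + p ≡ R q₂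
        R₁+p≡R₂ = m+[n∸m]≡n (⌊√⌋-monoˡ-≤ A (<⇒≤ q₁<q₂))
        W₂≡ : W (q + q₁) ≡ N * p + W q₁
        W₂≡ = begin
          W (q + q₁)                    ≡⟨ cong W q+q₁≡q₂ ⟩
          W q₂                          ≡⟨ W≡N*R+frac q₂ ⟩
          N * R q₂ + frac q₂            ≡⟨ cong₂ (λ r f → N * r + f) (sym R₁+p≡R₂) (sym frac≡) ⟩
          N * (R q₁ + p) + frac q₁      ≡⟨ cong (_+ frac q₁) (*-distribˡ-+ N (R q₁) p) ⟩
          N * R q₁ + N * p + frac q₁    ≡⟨ regroup (N * R q₁) (N * p) (frac q₁) ⟩
          N * p + (N * R q₁ + frac q₁)  ≡⟨ cong (N * p +_) (sym (W≡N*R+frac q₁)) ⟩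
          N * p + W q₁                  ∎
          where
          open ≡-Reasoning
          regroup : ∀ x y z → x + y + z ≡ y + (x + z)
          regroup = solve-∀

    -- frac q is the first base-N digit of the fractional part of q√A, so two of q = 0, …, N share it.
    dirichlet : ∃₂ (Close A N)
    dirichlet = from-collision (pigeonhole (n<1+n N) (λ (i : Fin (suc N)) → fromℕ< (frac<N (toℕ i))))
      where
      from-collision : (∃₂ λ i j → toℕ i < toℕ j × fromℕ< (frac<N (toℕ i)) ≡ fromℕ< (frac<N (toℕ j))) →
                       ∃₂ (Close A N)
      from-collision (i , j , i<j , fracᵢ≡fracⱼ) = collision⇒approximation i<j (≤-pred (toℕ<n j))
        (trans (sym (toℕ-fromℕ< (frac<N (toℕ i)))) (trans (cong toℕ fracᵢ≡fracⱼ) (toℕ-fromℕ< (frac<N (toℕ j)))))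

  near-isqrt : ∀ {X Y} → isqrt Y ≤ X → X ≤ suc (isqrt Y) → X * X ≤ Y + 2 * X × Y ≤ X * X + 2 * X
  near-isqrt {X} {Y} w≤X X≤1+w = X*X≤ X X≤1+w , Y≤
    where
    [1+x]² : ∀ x → suc x * suc x ≡ suc (x * x + 2 * x)
    [1+x]² = solve-∀
    Y≤ : Y ≤ X * X + 2 * X
    Y≤ = ≤-pred (<-≤-trans (isqrt-upper Y) (subst (suc (isqrt Y) * suc (isqrt Y) ≤_) ([1+x]² X) (*-mono-≤ (s≤s w≤X) (s≤s w≤X))))
    X*X≤ : ∀ X → X ≤ suc (isqrt Y) → X * X ≤ Y + 2 * X
    X*X≤ zero _ = z≤n
    X*X≤ (suc X′) (s≤s X′≤w) = subst₂ _≤_ (sym ([1+x]² X′)) (sym (Y+2*[1+x] Y X′))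
      (m≤n⇒m≤1+n (s≤s (+-monoˡ-≤ (2 * X′) (≤-trans (*-mono-≤ X′≤w X′≤w) (isqrt-lower Y)))))
      where
      Y+2*[1+x] : ∀ Y x → Y + 2 * suc x ≡ suc (suc (Y + 2 * x))
      Y+2*[1+x] = solve-∀

  module _ (N : ℕ) .{{_ : NonZero N}} (A p q : ℕ) where
    private
      W = ⌊ q √ (N * N * A) ⌋

    norm-bounds : W ≤ N * p → N * p ≤ suc W →
      N * (p * p) ≤ N * (A * (q * q)) + 2 * p × N * (A * (q * q)) ≤ N * (p * p) + 2 * p
    norm-bounds W≤Np Np≤1+W = *-cancelˡ-≤ {N * (p * p)} {N * (A * (q * q)) + 2 * p} N
        (subst₂ _≤_ ([Nx]² N p) (N²Aq²+2Np N A q p) upper) ,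
                             *-cancelˡ-≤ {N * (A * (q * q))} {N * (p * p) + 2 * p} N
                                 (subst₂ _≤_ (N²Aq² N A q) ([Np]²+2Np N p) lower)
      where
      upper : N * p * (N * p) ≤ N * N * A * (q * q) + 2 * (N * p)
      upper = proj₁ (near-isqrt W≤Np Np≤1+W)
      lower : N * N * A * (q * q) ≤ N * p * (N * p) + 2 * (N * p)
      lower = proj₂ (near-isqrt W≤Np Np≤1+W)
      [Nx]² : ∀ N x → N * x * (N * x) ≡ N * (N * (x * x))
      [Nx]² = solve-∀
      N²Aq² : ∀ N A q → N * N * A * (q * q) ≡ N * (N * (A * (q * q)))
      N²Aq² = solve-∀
      N²Aq²+2Np : ∀ N A q p → N * N * A * (q * q) + 2 * (N * p) ≡ N * (N * (A * (q * q)) + 2 * p)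
      N²Aq²+2Np = solve-∀
      [Np]²+2Np : ∀ N p → N * p * (N * p) + 2 * (N * p) ≡ N * (N * (p * p) + 2 * p)
      [Np]²+2Np = solve-∀

    numerator-bound : q ≤ N → N * p ≤ suc W → p ≤ N * suc (isqrt A)
    numerator-bound q≤N Np≤1+W = *-cancelˡ-≤ {p} {N * suc s} N
      (≤-trans Np≤1+W (subst (suc W ≤_) (*-assoc N N (suc s)) W<N²[1+s]))
      where
      open ≤-Reasoning
      s = isqrt A
      N²AN²≡N⁴A : ∀ N A → N * N * A * (N * N) ≡ N * N * (N * N) * A
      N²AN²≡N⁴A = solve-∀
      N⁴[1+s]²≡[N²[1+s]]² : ∀ N s → N * N * (N * N) * (suc s * suc s) ≡ N * N * suc s * (N * N * suc s)
      N⁴[1+s]²≡[N²[1+s]]² = solve-∀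
      W<N²[1+s] : W < N * N * suc s
      W<N²[1+s] = m*m<n*n⇒m<n (begin-strict
        W * W                                ≤⟨ isqrt-lower (N * N * A * (q * q)) ⟩
        N * N * A * (q * q)                  ≤⟨ *-monoʳ-≤ (N * N * A) (*-mono-≤ q≤N q≤N) ⟩
        N * N * A * (N * N)                  ≡⟨ N²AN²≡N⁴A N A ⟩
        N * N * (N * N) * A                  <⟨ *-monoʳ-< (N * N * (N * N)) {{m*n≢0 (N * N) (N * N) {{m*n≢0 N N}} {{m*n≢0 N N}}}}
            (isqrt-upper A) ⟩
        N * N * (N * N) * (suc s * suc s)    ≡⟨ N⁴[1+s]²≡[N²[1+s]]² N s ⟩
        N * N * suc s * (N * N * suc s)      ∎)

  -- Opaque: the witnesses come from an exhaustive search, which the type checker must never unfold.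
  opaque
    approximation : ∀ A N .{{_ : NonZero N}} → ∃₂ (Approximation A N)
    approximation A N = from-close (dirichlet A N)
      where
      from-close : ∃₂ (Close A N) → ∃₂ (Approximation A N)
      from-close (p , q , 1≤q , q≤N , W≤Np , Np≤1+W) =
        p , q , 1≤q , numerator-bound N A p q q≤N Np≤1+W , norm-bounds N A p q W≤Np Np≤1+W

module IntegerSquares where

  open import Data.Nat.Base as ℕ using (z≤n)
  open import Data.Integer.Base
  open import Data.Integer.Properties
  open import Relation.Binary.PropositionalEquality using (_≡_; refl; sym; subst; subst₂)

  open Squares using (m*m<n*n⇒m<n)

  +[∣i∣*∣i∣]≡i*i : ∀ i → + (∣ i ∣ ℕ.* ∣ i ∣) ≡ i * i
  +[∣i∣*∣i∣]≡i*i (+ n) = pos-* n n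
  +[∣i∣*∣i∣]≡i*i -[1+ n ] = refl

  0≤i*i : ∀ i → 0ℤ ≤ i * i
  0≤i*i i = subst (0ℤ ≤_) (+[∣i∣*∣i∣]≡i*i i) (+≤+ z≤n)

  i≤+∣i∣ : ∀ i → i ≤ + ∣ i ∣
  i≤+∣i∣ (+ n) = ≤-refl
  i≤+∣i∣ -[1+ n ] = -≤+

  i*i<j*j⇒i<j : ∀ {i j} → 0ℤ ≤ j → i * i < j * j → i < j
  i*i<j*j⇒i<j {i} {j} 0≤j i²<j² = ≤-<-trans (i≤+∣i∣ i) (subst (+ ∣ i ∣ <_) (0≤i⇒+∣i∣≡i 0≤j) (+<+ ∣i∣<∣j∣))
    where
    ∣i∣<∣j∣ : ∣ i ∣ ℕ.< ∣ j ∣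
    ∣i∣<∣j∣ = m*m<n*n⇒m<n (drop‿+<+ (subst₂ _<_ (sym (+[∣i∣*∣i∣]≡i*i i)) (sym (+[∣i∣*∣i∣]≡i*i j)) i²<j²))

module PellComposition where

  open import Data.Nat.Base as ℕ using (ℕ)
  import Data.Nat.Properties as ℕ
  open import Data.Integer.Base
  open import Data.Integer.Properties
  open import Data.Integer.Tactic.RingSolver using (solve-∀)
  open import Data.Product.Base using (∃₂; _×_; _,_)
  open import Function.Base using (_∘_)
  open import Relation.Binary.PropositionalEquality

  open import Defs
  open IntegerSquares using (+[∣i∣*∣i∣]≡i*i)

  pell-solution : ∀ {A X Y} → X * X ≡ + A * (Y * Y) + 1ℤ → Y ≢ 0ℤ → PellSolution A ∣ Y ∣
  pell-solution {A} {X} {Y} X²≡AY²+1 Y≢0 = ℕ.n≢0⇒n>0 (Y≢0 ∘ ∣i∣≡0⇒i≡0) , ∣ X ∣ , 0<∣X∣ , ∣X∣²≡A∣Y∣²+1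
    where
    ∣X∣²≡A∣Y∣²+1 : ∣ X ∣ ℕ.* ∣ X ∣ ≡ A ℕ.* (∣ Y ∣ ℕ.* ∣ Y ∣) ℕ.+ 1
    ∣X∣²≡A∣Y∣²+1 = +-injective (begin
      + (∣ X ∣ ℕ.* ∣ X ∣)                ≡⟨ +[∣i∣*∣i∣]≡i*i X ⟩
      X * X                              ≡⟨ X²≡AY²+1 ⟩
      + A * (Y * Y) + 1ℤ                 ≡⟨ cong (λ n → + A * n + 1ℤ) (sym (+[∣i∣*∣i∣]≡i*i Y)) ⟩
      + A * + (∣ Y ∣ ℕ.* ∣ Y ∣) + 1ℤ     ≡⟨ cong (_+ 1ℤ) (pos-* A _) ⟨
      + (A ℕ.* (∣ Y ∣ ℕ.* ∣ Y ∣)) + 1ℤ   ≡⟨ pos-+ _ 1 ⟨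
      + (A ℕ.* (∣ Y ∣ ℕ.* ∣ Y ∣) ℕ.+ 1)  ∎)
      where open ≡-Reasoning
    0<∣X∣ : 0 ℕ.< ∣ X ∣
    0<∣X∣ = ℕ.n≢0⇒n>0 λ ∣X∣≡0 → ℕ.1+n≢0
      (trans (ℕ.+-comm 1 _) (trans (sym ∣X∣²≡A∣Y∣²+1) (cong (λ n → n ℕ.* n) ∣X∣≡0)))

  private
    composition-identity : ∀ A p q α β → let k = p * p - A * (q * q) ; X = 1ℤ + α * p - A * β * q ; Y = α * q - β * p in
      k * k * (X * X - A * (Y * Y)) ≡ ((p + k * α) * (p + k * α) - A * ((q + k * β) * (q + k * β))) * k
    composition-identity = solve-∀

    cross-identity : ∀ A p q α β → let k = p * p - A * (q * q) ; Y = α * q - β * p ; p′ = p + k * α ; q′ = q + k * β in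
      (q′ * q′ - q * q) * k ≡ q * q * (p′ * p′ - A * (q′ * q′)) - q * q * k - k * Y * (q′ * p + q * p′)
    cross-identity = solve-∀

    x≡y+[x-y] : ∀ x y → x ≡ y + (x - y)
    x≡y+[x-y] = solve-∀

    x-x-k*0*z≡0 : ∀ x k z → x - x - k * 0ℤ * z ≡ 0ℤ
    x-x-k*0*z≡0 = solve-∀

  -- X = (p₁p₂ - A q₁q₂) / k and Y = (p₁q₂ - p₂q₁) / k compose (p₁, q₁) with the conjugate of (p₂, q₂);
  -- the congruences make both divisions exact.
  congruent-composition : ∀ {A k p₁ q₁ p₂ q₂ α β} .{{_ : NonZero k}} →
    p₁ * p₁ - A * (q₁ * q₁) ≡ k → p₂ * p₂ - A * (q₂ * q₂) ≡ k → p₁ ≡ p₂ + k * α → q₁ ≡ q₂ + k * β →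
    ∃₂ λ X Y → X * X ≡ A * (Y * Y) + 1ℤ × (Y ≡ 0ℤ → q₁ * q₁ ≡ q₂ * q₂)
  congruent-composition {A} {k} {p₂ = p} {q} {α} {β} norm₁≡k refl refl refl = X , Y , X²≡AY²+1 , q₁²≡q₂²
    where
    X = 1ℤ + α * p - A * β * q
    Y = α * q - β * p
    p′ = p + k * α
    q′ = q + k * β
    norm₁ = p′ * p′ - A * (q′ * q′)
    X²-AY²≡1 : X * X - A * (Y * Y) ≡ 1ℤ
    X²-AY²≡1 = *-cancelˡ-≡ (k * k) (X * X - A * (Y * Y)) 1ℤ {{i*j≢0 k k}} (begin
      k * k * (X * X - A * (Y * Y))  ≡⟨ composition-identity A p q α β ⟩
      norm₁ * k                      ≡⟨ cong (_* k) norm₁≡k ⟩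
      k * k                          ≡⟨ *-identityʳ (k * k) ⟨
      k * k * 1ℤ                     ∎)
      where open ≡-Reasoning
    X²≡AY²+1 : X * X ≡ A * (Y * Y) + 1ℤ
    X²≡AY²+1 = trans (x≡y+[x-y] (X * X) (A * (Y * Y))) (cong (λ n → A * (Y * Y) + n) X²-AY²≡1)
    q₁²≡q₂² : Y ≡ 0ℤ → q′ * q′ ≡ q * q
    q₁²≡q₂² Y≡0 = i-j≡0⇒i≡j (q′ * q′) (q * q) (*-cancelʳ-≡ (q′ * q′ - q * q) 0ℤ k (begin
      (q′ * q′ - q * q) * k                                 ≡⟨ cross-identity A p q α β ⟩
      q * q * norm₁ - q * q * k - k * Y * (q′ * p + q * p′)  ≡⟨ cong₂ (λ n y → q * q * n - q * q * k - k * y * (q′ * p + q * p′)) norm₁≡k Y≡0 ⟩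
      q * q * k - q * q * k - k * 0ℤ * (q′ * p + q * p′)     ≡⟨ x-x-k*0*z≡0 (q * q * k) k (q′ * p + q * p′) ⟩
      0ℤ                                                    ≡⟨ *-zeroˡ k ⟨
      0ℤ * k                                                ∎))
      where open ≡-Reasoning

module PellExistence where

  open import Data.Nat.Base as ℕ using (ℕ; zero; suc; z≤n; s≤s)
  import Data.Nat.Properties as ℕ
  open import Data.Nat.DivMod using (_%_; _/_; m≡m%n+[m/n]*n; m%n<n; %-congʳ)
  open import Data.Nat.Primality using (Prime)
  open import Data.Integer.Base hiding (_/_; _%_; suc)
  open import Data.Integer.Properties
  open import Data.Integer.Tactic.RingSolver using (solve-∀)
  open import Algebra.Properties.AbelianGroup +-0-abelianGroup using (∙-cancelʳ)
  open import Data.Fin.Base as Fin using (Fin; toℕ; fromℕ<; combine)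
  open import Data.Fin.Properties using (pigeonhole; combine-injective; fromℕ<-injective)
  open import Data.Product.Base using (Σ; ∃; ∃₂; _×_; _,_; proj₁; proj₂)
  open import Data.Sum.Base using (_⊎_; inj₁; inj₂)
  open import Relation.Binary.Definitions using (tri<; tri≈; tri>)
  open import Relation.Binary.PropositionalEquality
  open import Relation.Nullary.Decidable using (yes; no)
  open import Relation.Nullary.Negation using (contradiction)

  open import Defs
  open Squares
  open PrimeSquares
  open Dirichlet
  open PellComposition

  private
    r+q*K≡r+q′*K+K*[q-q′] : ∀ r q q′ K → r + q * K ≡ (r + q′ * K) + K * (q - q′)
    r+q*K≡r+q′*K+K*[q-q′] = solve-∀

    -k*δ≡k*-δ : ∀ k δ → - k * δ ≡ k * - δ
    -k*δ≡k*-δ = solve-∀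

    +[r+q*K] : ∀ r q K → + (r ℕ.+ q ℕ.* K) ≡ + r + + q * + K
    +[r+q*K] r q K = trans (pos-+ r (q ℕ.* K)) (cong (λ x → + r + x) (pos-* q K))

  %-≡⇒congruent : ∀ k .{{_ : NonZero k}} m n → m % ∣ k ∣ ≡ n % ∣ k ∣ → ∃ λ α → + m ≡ + n + k * α
  %-≡⇒congruent k m n m%≡n% = multiple-of-k (+∣i∣≡i⊎+∣i∣≡-i k)
    where
    K = ∣ k ∣
    δ = + (m / K) - + (n / K)
    m≡n+Kδ : + m ≡ + n + + K * δ
    m≡n+Kδ = begin
      + m                                      ≡⟨ cong +_ (m≡m%n+[m/n]*n m K) ⟩
      + (m % K ℕ.+ m / K ℕ.* K)                ≡⟨ +[r+q*K] (m % K) (m / K) K ⟩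
      + (m % K) + + (m / K) * + K              ≡⟨ cong (λ r → + r + + (m / K) * + K) m%≡n% ⟩
      + (n % K) + + (m / K) * + K              ≡⟨ r+q*K≡r+q′*K+K*[q-q′] (+ (n % K)) (+ (m / K)) (+ (n / K)) (+ K) ⟩
      + (n % K) + + (n / K) * + K + + K * δ    ≡⟨ cong (λ x → x + + K * δ) (+[r+q*K] (n % K) (n / K) K) ⟨
      + (n % K ℕ.+ n / K ℕ.* K) + + K * δ      ≡⟨ cong (λ x → + x + + K * δ) (m≡m%n+[m/n]*n n K) ⟨
      + n + + K * δ                            ∎
      where open ≡-Reasoning
    multiple-of-k : + K ≡ k ⊎ + K ≡ - k → ∃ λ α → + m ≡ + n + k * α
    multiple-of-k (inj₁ K≡k) = δ , trans m≡n+Kδ (cong (λ K → + n + K * δ) K≡k)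
    multiple-of-k (inj₂ K≡-k) = - δ , trans m≡n+Kδ (cong (λ x → + n + x) (trans (cong (_* δ) K≡-k) (-k*δ≡k*-δ k δ)))

  ∣m-n∣≤ : ∀ {m n B} → m ℕ.≤ n ℕ.+ B → n ℕ.≤ m ℕ.+ B → ∣ + m - + n ∣ ℕ.≤ B
  ∣m-n∣≤ {m} {n} m≤n+B n≤m+B with m ℕ.≤? n
  ... | yes m≤n = subst (ℕ._≤ _) (sym (trans (cong ∣_∣ (m-n≡m⊖n m n)) (∣⊖∣-≤ m≤n))) (ℕ.m≤n+o⇒m∸n≤o n m n≤m+B)
  ... | no m≰n = subst (ℕ._≤ _) (sym (trans (cong ∣_∣ (m-n≡m⊖n m n)) (trans (∣m⊖n∣≡∣n⊖m∣ m n) (∣⊖∣-≤ n≤m))))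
                   (ℕ.m≤n+o⇒m∸n≤o m n m≤n+B)
    where n≤m = ℕ.<⇒≤ (ℕ.≰⇒> m≰n)

  0≤k+B : ∀ k {B} → ∣ k ∣ ℕ.≤ B → 0ℤ ≤ k + + B
  0≤k+B (+ n) _ = +≤+ z≤n
  0≤k+B -[1+ n ] {B} 1+n≤B = subst (0ℤ ≤_) (sym (⊖-≥ 1+n≤B)) (+≤+ z≤n)

  private
    close-multiples⇒N≤c : ∀ N {m n c} → m ℕ.< n → N ℕ.* n ℕ.≤ N ℕ.* m ℕ.+ c → N ℕ.≤ c
    close-multiples⇒N≤c N {m} {n} {c} m<n Nn≤Nm+c = ℕ.+-cancelʳ-≤ (N ℕ.* m) N c (begin
      N ℕ.+ N ℕ.* m    ≡⟨ ℕ.*-suc N m ⟨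
      N ℕ.* suc m      ≤⟨ ℕ.*-monoʳ-≤ N m<n ⟩
      N ℕ.* n          ≤⟨ Nn≤Nm+c ⟩
      N ℕ.* m ℕ.+ c    ≡⟨ ℕ.+-comm (N ℕ.* m) c ⟩
      c ℕ.+ N ℕ.* m    ∎)
      where open ℕ.≤-Reasoning

    distinct-close-multiples⇒N≤c : ∀ N {m n c} → m ≢ n → N ℕ.* m ℕ.≤ N ℕ.* n ℕ.+ c →
        N ℕ.* n ℕ.≤ N ℕ.* m ℕ.+ c → N ℕ.≤ c
    distinct-close-multiples⇒N≤c N {m} {n} m≢n Nm≤Nn+c Nn≤Nm+c with ℕ.<-cmp m n
    ... | tri< m<n _ _ = close-multiples⇒N≤c N m<n Nn≤Nm+c
    ... | tri≈ _ m≡n _ = contradiction m≡n m≢n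
    ... | tri> _ _ n<m = close-multiples⇒N≤c N n<m Nm≤Nn+c

    close-multiples⇒close : ∀ N .{{_ : ℕ.NonZero N}} {m n c B} → N ℕ.* m ℕ.≤ N ℕ.* n ℕ.+ c →
        c ℕ.≤ N ℕ.* B → m ℕ.≤ n ℕ.+ B
    close-multiples⇒close N {m} {n} {c} {B} Nm≤Nn+c c≤NB = ℕ.*-cancelˡ-≤ N (begin
      N ℕ.* m              ≤⟨ Nm≤Nn+c ⟩
      N ℕ.* n ℕ.+ c        ≤⟨ ℕ.+-monoʳ-≤ (N ℕ.* n) c≤NB ⟩
      N ℕ.* n ℕ.+ N ℕ.* B  ≡⟨ ℕ.*-distribˡ-+ N n B ⟨
      N ℕ.* (n ℕ.+ B)      ∎)
      where open ℕ.≤-Reasoning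

  encode : ∀ {a b c X Y Z} → a ℕ.< X → b ℕ.< Y → c ℕ.< Z → Fin (X ℕ.* Y ℕ.* Z)
  encode a<X b<Y c<Z = combine (combine (fromℕ< a<X) (fromℕ< b<Y)) (fromℕ< c<Z)

  encode-injective : ∀ {a b c a′ b′ c′ X Y Z} (a<X : a ℕ.< X) (b<Y : b ℕ.< Y) (c<Z : c ℕ.< Z)
    (a′<X : a′ ℕ.< X) (b′<Y : b′ ℕ.< Y) (c′<Z : c′ ℕ.< Z) →
    encode a<X b<Y c<Z ≡ encode a′<X b′<Y c′<Z → a ≡ a′ × b ≡ b′ × c ≡ c′
  encode-injective a<X b<Y c<Z a′<X b′<Y c′<Z eq
    with combine-injective (combine (fromℕ< a<X) (fromℕ< b<Y)) (fromℕ< c<Z)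
        (combine (fromℕ< a′<X) (fromℕ< b′<Y)) (fromℕ< c′<Z) eq
  ... | ab≡a′b′ , c≡c′ with combine-injective (fromℕ< a<X) (fromℕ< b<Y) (fromℕ< a′<X) (fromℕ< b′<Y) ab≡a′b′
  ...   | a≡a′ , b≡b′ = fromℕ<-injective _ _ a<X a′<X a≡a′ ,
      fromℕ<-injective _ _ b<Y b′<Y b≡b′ , fromℕ<-injective _ _ c<Z c′<Z c≡c′

  module _ {A : ℕ} (A-prime : Prime A) where

    B : ℕ
    B = 2 ℕ.* suc (isqrt A)

    norm : ℕ → ℕ → ℤ
    norm p q = + p * + p - + A * (+ q * + q)

    record Approximant : Set where
      field
        p q : ℕ
        norm≢0 : NonZero (norm p q)
        ∣norm∣≤B : ∣ norm p q ∣ ℕ.≤ B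

    small-norm-beyond : ∀ P → Σ Approximant λ a → P ℕ.< Approximant.p a
    small-norm-beyond P = from-approximation (approximation A N)
      where
      N = suc (P ℕ.+ P)
      from-approximation : ∃₂ (Approximation A N) → Σ Approximant λ a → P ℕ.< Approximant.p a
      from-approximation (p , q , 1≤q , p≤N[1+s] , upper , lower) =
        record { p = p ; q = q ; norm≢0 = ≢-nonZero norm≢0 ; ∣norm∣≤B = ∣norm∣≤B } , P<p
        where
        p²≢Aq² : p ℕ.* p ≢ A ℕ.* (q ℕ.* q)
        p²≢Aq² eq = contradiction (p*p≡A*[q*q]⇒q≡0 A-prime p q eq) (ℕ.n>0⇒n≢0 1≤q)
        P<p : P ℕ.< p
        P<p = ℕ.*-cancelˡ-< 2 P p (ℕ.<-≤-trans (subst (ℕ._< N) (cong (P ℕ.+_) (sym (ℕ.+-identityʳ P))) (ℕ.n<1+n (P ℕ.+ P)))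
                                   (distinct-close-multiples⇒N≤c N p²≢Aq² upper lower))
        2p≤NB : 2 ℕ.* p ℕ.≤ N ℕ.* B
        2p≤NB = subst (2 ℕ.* p ℕ.≤_) 2*[N*s]≡N*[2*s] (ℕ.*-monoʳ-≤ 2 p≤N[1+s])
          where
          s = suc (isqrt A)
          2*[N*s]≡N*[2*s] : 2 ℕ.* (N ℕ.* s) ≡ N ℕ.* (2 ℕ.* s)
          2*[N*s]≡N*[2*s] = trans (sym (ℕ.*-assoc 2 N s)) (trans (cong (ℕ._* s) (ℕ.*-comm 2 N)) (ℕ.*-assoc N 2 s))
        norm≡ : norm p q ≡ + (p ℕ.* p) - + (A ℕ.* (q ℕ.* q))
        norm≡ = cong₂ _-_ (sym (pos-* p p)) (trans (cong (+ A *_) (sym (pos-* q q))) (sym (pos-* A (q ℕ.* q))))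
        ∣norm∣≤B : ∣ norm p q ∣ ℕ.≤ B
        ∣norm∣≤B = subst (λ k → ∣ k ∣ ℕ.≤ B) (sym norm≡)
          (∣m-n∣≤ (close-multiples⇒close N upper 2p≤NB) (close-multiples⇒close N lower 2p≤NB))
        norm≢0 : norm p q ≢ 0ℤ
        norm≢0 norm≡0 = p²≢Aq² (+-injective (i-j≡0⇒i≡j _ _ (trans (sym norm≡) norm≡0)))

    open Approximant

    approximant : ℕ → Approximant
    approximant zero = proj₁ (small-norm-beyond 0)
    approximant (suc n) = proj₁ (small-norm-beyond (p (approximant n)))

    numerator-strictly-increasing : ∀ {m n} → m ℕ.< n → p (approximant m) ℕ.< p (approximant n)
    numerator-strictly-increasing {m} {suc n} (s≤s m≤n) with ℕ.m≤n⇒m<n∨m≡n m≤n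
    ... | inj₁ m<n = ℕ.<-trans (numerator-strictly-increasing m<n) (proj₂ (small-norm-beyond (p (approximant n))))
    ... | inj₂ refl = proj₂ (small-norm-beyond (p (approximant n)))

    private
      module Class (a : Approximant) where
        k = norm (p a) (q a)
        instance _ = norm≢0 a
        k-index< : ∣ k + + B ∣ ℕ.< suc (B ℕ.+ B)
        k-index< = s≤s (ℕ.≤-trans (∣i+j∣≤∣i∣+∣j∣ k (+ B)) (ℕ.+-monoˡ-≤ B (∣norm∣≤B a)))
        residue< : ∀ n → n % ∣ k ∣ ℕ.< B
        residue< n = ℕ.<-≤-trans (m%n<n n ∣ k ∣) (∣norm∣≤B a)

    class : Approximant → Fin (suc (B ℕ.+ B) ℕ.* B ℕ.* B)
    class a = encode k-index< (residue< (p a)) (residue< (q a))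
      where open Class a

    same-class⇒congruent : ∀ a b → class a ≡ class b →
      norm (p a) (q a) ≡ norm (p b) (q b) ×
      (∃ λ α → + p a ≡ + p b + norm (p a) (q a) * α) × (∃ λ β → + q a ≡ + q b + norm (p a) (q a) * β)
    same-class⇒congruent a b class≡ =
      kₐ≡k_b , congruent (p a) (p b) (proj₁ (proj₂ same-codes)) , congruent (q a) (q b) (proj₂ (proj₂ same-codes))
      where
      module a = Class a
      module b = Class b
      instance
        _ = norm≢0 a
        _ = norm≢0 b
      same-codes : ∣ a.k + + B ∣ ≡ ∣ b.k + + B ∣ × p a % ∣ a.k ∣ ≡ p b % ∣ b.k ∣ × q a % ∣ a.k ∣ ≡ q b % ∣ b.k ∣
      same-codes = encode-injective a.k-index< (a.residue< (p a)) (a.residue< (q a))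
                                    b.k-index< (b.residue< (p b)) (b.residue< (q b)) class≡
      kₐ≡k_b : a.k ≡ b.k
      kₐ≡k_b = ∙-cancelʳ (+ B) a.k b.k (begin
        a.k + + B          ≡⟨ 0≤i⇒+∣i∣≡i (0≤k+B a.k (∣norm∣≤B a)) ⟨
        + ∣ a.k + + B ∣    ≡⟨ cong +_ (proj₁ same-codes) ⟩
        + ∣ b.k + + B ∣    ≡⟨ 0≤i⇒+∣i∣≡i (0≤k+B b.k (∣norm∣≤B b)) ⟩
        b.k + + B          ∎)
        where open ≡-Reasoning
      congruent : ∀ n m → n % ∣ a.k ∣ ≡ m % ∣ b.k ∣ → ∃ λ α → + n ≡ + m + a.k * α
      congruent n m n%≡m% = %-≡⇒congruent a.k n m (trans n%≡m% (%-congʳ (cong ∣_∣ (sym kₐ≡k_b))))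

    same-class⇒pell : ∀ a b → p a ≢ p b → class a ≡ class b → ∃ (PellSolution A)
    same-class⇒pell a b pₐ≢p_b class≡ = ∣ Y ∣ , pell-solution {A} {X} {Y} X²≡AY²+1 Y≢0
      where
      instance _ = norm≢0 a
      kₐ≡k_b : norm (p a) (q a) ≡ norm (p b) (q b)
      kₐ≡k_b = proj₁ (same-class⇒congruent a b class≡)
      p-cong : ∃ λ α → + p a ≡ + p b + norm (p a) (q a) * α
      p-cong = proj₁ (proj₂ (same-class⇒congruent a b class≡))
      q-cong : ∃ λ β → + q a ≡ + q b + norm (p a) (q a) * β
      q-cong = proj₂ (proj₂ (same-class⇒congruent a b class≡))
      composition : ∃₂ λ X Y → X * X ≡ + A * (Y * Y) + 1ℤ × (Y ≡ 0ℤ → + q a * + q a ≡ + q b * + q b)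
      composition = congruent-composition {A = + A} {p₂ = + p b} {q₂ = + q b} {α = proj₁ p-cong} {β = proj₁ q-cong}
                      refl (sym kₐ≡k_b) (proj₂ p-cong) (proj₂ q-cong)
      X = proj₁ composition
      Y = proj₁ (proj₂ composition)
      X²≡AY²+1 = proj₁ (proj₂ (proj₂ composition))
      Y≢0 : Y ≢ 0ℤ
      Y≢0 Y≡0 = pₐ≢p_b (m*m≡n*n⇒m≡n (+-injective (trans (pos-* (p a) (p a)) (trans pₐ²≡p_b² (sym (pos-* (p b) (p b)))))))
        where
        qₐ≡q_b : q a ≡ q b
        qₐ≡q_b = m*m≡n*n⇒m≡n (+-injective (trans (pos-* (q a) (q a))
            (trans (proj₂ (proj₂ (proj₂ composition)) Y≡0) (sym (pos-* (q b) (q b))))))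
        pₐ²≡p_b² : + p a * + p a ≡ + p b * + p b
        pₐ²≡p_b² = ∙-cancelʳ (- (+ A * (+ q b * + q b))) (+ p a * + p a) (+ p b * + p b)
                     (subst (λ n → + p a * + p a - + A * (+ n * + n) ≡ norm (p b) (q b)) qₐ≡q_b kₐ≡k_b)

    pell-solution-exists : ∃ (PellSolution A)
    pell-solution-exists = from-collision (pigeonhole (ℕ.n<1+n _) (λ i → class (approximant (toℕ i))))
      where
      from-collision : (∃₂ λ i j → i Fin.< j × class (approximant (toℕ i)) ≡ class (approximant (toℕ j)))
          → ∃ (PellSolution A)
      from-collision (i , j , i<j , class≡) = same-class⇒pell (approximant (toℕ i)) (approximant (toℕ j))
        (ℕ.<⇒≢ (numerator-strictly-increasing i<j)) class≡

module MinimalSolution where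

  open import Data.Nat.Base
  open import Data.Nat.Properties
  open import Data.Nat.Induction using (<-rec)
  open import Data.Nat.Primality using (Prime)
  open import Data.Product.Base using (∃; _×_; _,_; proj₂)
  open import Relation.Binary.PropositionalEquality
  open import Relation.Nullary.Decidable using (yes; no; map′)
  open import Relation.Unary using (Decidable)

  open import Defs
  open Squares
  open PellExistence using (pell-solution-exists)

  least-witness : ∀ {P : ℕ → Set} → Decidable P → ∀ {n} → P n → ∃ λ m → P m × (∀ k → P k → m ≤ k)
  least-witness {P} P? {n} = <-rec (λ n → P n → Least) least n
    where
    Least : Set
    Least = ∃ λ m → P m × (∀ k → P k → m ≤ k)
    least : ∀ n → (∀ {m} → m < n → P m → Least) → P n → Least
    least n rec Pn with anyUpTo? P? n
    ... | yes (m , m<n , Pm) = rec m<n Pm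
    ... | no ∄smaller = n , Pn , λ k Pk → ≮⇒≥ λ k<n → ∄smaller (k , k<n , Pk)

  pell-solution? : ∀ A → Decidable (PellSolution A)
  pell-solution? A zero = no λ ()
  pell-solution? A (suc x) = map′ (λ (y , y²≡) → s≤s z≤n , y , m*m≡n+1⇒0<m y²≡ , y²≡) (λ (_ , y , _ , y²≡) → y , y²≡)
                                  (square? (A * (suc x * suc x) + 1))

  minimal-pell-solution : ∀ {A} → Prime A → ∃ (MinimalPellSolution A)
  minimal-pell-solution {A} A-prime = least-witness (pell-solution? A) (proj₂ (pell-solution-exists A-prime))

module MinimalSolutionFactorisation where

  open import Data.Nat.Base
  open import Data.Nat.Properties
  open import Data.Nat.Divisibility
  open import Data.Nat.DivMod using (_%_; _/_; m≡m%n+[m/n]*n)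
  open import Data.Nat.Primality using (Prime; euclidsLemma; prime[2]; prime⇒nonZero)
  open import Data.Nat.Tactic.RingSolver using (solve-∀)
  open import Data.Product.Base using (∃; ∃₂; _×_; _,_)
  open import Data.Sum.Base using (_⊎_; inj₁; inj₂)
  open import Relation.Binary.PropositionalEquality
  open import Data.Empty using (⊥)
  open import Relation.Nullary.Negation using (¬_; contradiction)

  open import Defs
  open Squares
  open PrimeSquares

  even-or-odd : ∀ n → ∃ λ k → n ≡ k * 2 ⊎ n ≡ 1 + k * 2
  even-or-odd zero = 0 , inj₁ refl
  even-or-odd (suc n) with even-or-odd n
  ... | k , inj₁ refl = k , inj₂ refl
  ... | k , inj₂ refl = suc k , inj₁ refl

  2∤A : ∀ {A} → A % 8 ≡ 7 → ¬ 2 ∣ A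
  2∤A {A} A%8≡7 2∣A = 2∤1+k*2 (3 + A / 8 * 4) (subst (2 ∣_) A≡1+[3+q*4]*2 2∣A)
    where
    7+q*8≡1+[3+q*4]*2 : ∀ q → 7 + q * 8 ≡ 1 + (3 + q * 4) * 2
    7+q*8≡1+[3+q*4]*2 = solve-∀
    A≡1+[3+q*4]*2 : A ≡ 1 + (3 + A / 8 * 4) * 2
    A≡1+[3+q*4]*2 = trans (m≡m%n+[m/n]*n A 8) (trans (cong (_+ A / 8 * 8) A%8≡7) (7+q*8≡1+[3+q*4]*2 (A / 8)))

  private
    [2+k*2]²≡[1+k*2]*[3+k*2]+1 : ∀ k → (2 + k * 2) * (2 + k * 2) ≡ (1 + k * 2) * (3 + k * 2) + 1
    [2+k*2]²≡[1+k*2]*[3+k*2]+1 = solve-∀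

    [1+h*2]²≡h*[h+1]*4+1 : ∀ h → (1 + h * 2) * (1 + h * 2) ≡ h * (h + 1) * 4 + 1
    [1+h*2]²≡h*[h+1]*4+1 = solve-∀

    A*[g*2]²≡A*g²*4 : ∀ A g → A * (g * 2 * (g * 2)) ≡ A * (g * g) * 4
    A*[g*2]²≡A*g²*4 = solve-∀

    h*[h+1]*4≡h*[h+1]*2*2 : ∀ h → h * (h + 1) * 4 ≡ h * (h + 1) * 2 * 2
    h*[h+1]*4≡h*[h+1]*2*2 = solve-∀

  odd-neighbours-factorisation : ∀ {A x k} → Prime A → A % 8 ≡ 7 → (1 + k * 2) * (3 + k * 2) ≡ A * (x * x) →
    ∃₂ λ u d → u * u ≡ A * (d * d) + 2 × x ≡ u * d
  odd-neighbours-factorisation {A} {x} {k} A-prime A%8≡7 eq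
    with coprime-product-prime-square A-prime (consecutive-odd-coprime k) eq
  ... | inj₁ (s , t , 1+k*2≡A*s² , 3+k*2≡t² , x≡s*t) =
    t , s , trans (sym 3+k*2≡t²) (trans (+-comm 2 (1 + k * 2)) (cong (_+ 2) 1+k*2≡A*s²)) , trans x≡s*t (*-comm s t)
  ... | inj₂ (s , t , 1+k*2≡s² , 3+k*2≡A*t² , _) =
    contradiction (trans (cong (_+ 2) (sym 1+k*2≡s²)) (trans (+-comm (1 + k * 2) 2) 3+k*2≡A*t²))
                  (mod-8-obstruction {A} s t A%8≡7 (inj₂ refl))

  consecutive-factorisation-impossible : ∀ {A x h} → Prime A → A % 8 ≡ 7 → MinimalPellSolution A x →
    h * (h + 1) * 4 ≢ A * (x * x)
  consecutive-factorisation-impossible {A} {x} {h} A-prime A%8≡7 ((x>0 , _) , x-minimal) eq =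
    impossible (coprime-product-prime-square A-prime (consecutive-coprime h) h*[h+1]≡A*g²)
    where
    instance _ = prime⇒nonZero A-prime
    2∣x : 2 ∣ x
    2∣x with euclidsLemma A (x * x) prime[2] (divides (h * (h + 1) * 2) (trans (sym eq) (h*[h+1]*4≡h*[h+1]*2*2 h)))
    ... | inj₁ 2∣A = contradiction 2∣A (2∤A A%8≡7)
    ... | inj₂ 2∣x*x = prime∣m*m⇒prime∣m prime[2] 2∣x*x
    g = quotient 2∣x
    x≡g*2 : x ≡ g * 2
    x≡g*2 = m∣n⇒n≡quotient*m 2∣x
    g>0 : 0 < g
    g>0 = n≢0⇒n>0 λ g≡0 → <-irrefl (sym (trans x≡g*2 (cong (_* 2) g≡0))) x>0
    h*[h+1]≡A*g² : h * (h + 1) ≡ A * (g * g)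
    h*[h+1]≡A*g² = *-cancelʳ-≡ (h * (h + 1)) (A * (g * g)) 4
      (trans eq (trans (cong (λ x → A * (x * x)) x≡g*2) (A*[g*2]²≡A*g²*4 A g)))
    impossible : (∃₂ λ s t → h ≡ A * (s * s) × h + 1 ≡ t * t × g ≡ s * t) ⊎
                 (∃₂ λ s t → h ≡ s * s × h + 1 ≡ A * (t * t) × g ≡ s * t) → ⊥
    impossible (inj₁ (s , t , h≡A*s² , h+1≡t² , g≡s*t)) = <-irrefl refl (≤-<-trans x≤s s<x)
      where
      t²≡A*s²+1 : t * t ≡ A * (s * s) + 1
      t²≡A*s²+1 = trans (sym h+1≡t²) (cong (_+ 1) h≡A*s²)
      t>0 : 0 < t
      t>0 = m*m≡n+1⇒0<m (sym h+1≡t²)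
      s>0 : 0 < s
      s>0 = n≢0⇒n>0 λ s≡0 → <-irrefl (sym (trans g≡s*t (cong (_* t) s≡0))) g>0
      x≤s : x ≤ s
      x≤s = x-minimal s (s>0 , t , t>0 , t²≡A*s²+1)
      s<x : s < x
      s<x = begin-strict
        s      ≤⟨ m≤m*n s t {{>-nonZero t>0}} ⟩
        s * t  ≡⟨ g≡s*t ⟨
        g      <⟨ m<m*n g 2 {{>-nonZero g>0}} (s≤s (s≤s z≤n)) ⟩
        g * 2  ≡⟨ x≡g*2 ⟨
        x      ∎
        where open ≤-Reasoning
    impossible (inj₂ (s , t , h≡s² , h+1≡A*t² , _)) =
      mod-8-obstruction {A} s t A%8≡7 (inj₁ refl) (trans (cong (_+ 1) (sym h≡s²)) h+1≡A*t²)

  minimal-solution-factorisation : ∀ {A x} → Prime A → A % 8 ≡ 7 → MinimalPellSolution A x →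
    ∃₂ λ u d → u * u ≡ A * (d * d) + 2 × x ≡ u * d
  minimal-solution-factorisation {A} {x} A-prime A%8≡7 minimal@((x>0 , y , y>0 , y²≡Ax²+1) , _) with even-or-odd y
  ... | zero , inj₁ refl = contradiction y>0 λ ()
  ... | suc k , inj₁ refl = odd-neighbours-factorisation {A} {x} {k} A-prime A%8≡7
          (+-cancelʳ-≡ 1 _ _ (trans (sym ([2+k*2]²≡[1+k*2]*[3+k*2]+1 k)) y²≡Ax²+1))
  ... | h , inj₂ refl = contradiction (+-cancelʳ-≡ 1 _ _ (trans (sym ([1+h*2]²≡h*[h+1]*4+1 h)) y²≡Ax²+1))
          (consecutive-factorisation-impossible {A} {x} {h} A-prime A%8≡7 minimal)

module BinaryForms where

  open import Data.Nat.Base as ℕ using (ℕ; zero; suc; z≤n; s≤s)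
  import Data.Nat.Properties as ℕ
  open import Data.Integer.Base hiding (suc)
  open import Data.Integer.Properties
  open import Data.Integer.DivMod using (_%ℕ_; _/ℕ_; a≡a%ℕn+[a/ℕn]*n; n%ℕd<d)
  open import Data.Integer.Tactic.RingSolver using (solve-∀)
  import Data.Nat.Tactic.RingSolver as ℕ-Solver
  open import Data.Product.Base using (∃; ∃₂; _,_)
  open import Data.Sum.Base using (_⊎_; inj₁; inj₂)
  open import Relation.Binary.PropositionalEquality
  open import Relation.Nullary.Decidable using (Dec; yes; no)
  open import Relation.Nullary.Negation using (¬_; contradiction)

  open IntegerSquares using (+[∣i∣*∣i∣]≡i*i)

  IsUnit : ℤ → Set
  IsUnit q = q ≡ 1ℤ ⊎ q ≡ -1ℤ

  IsUnit-neg : ∀ {q} → IsUnit q → IsUnit (- q)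
  IsUnit-neg (inj₁ refl) = inj₂ refl
  IsUnit-neg (inj₂ refl) = inj₁ refl

  form : ℤ → ℤ → ℤ → ℤ → ℤ → ℤ
  form a b c x y = a * x * x + b * x * y + c * y * y

  private
    shift-down : ∀ r q m → r + q * (+ 2 * m) + + 2 * m * - q ≡ r
    shift-down = solve-∀

    shift-down-more : ∀ r q m → r + q * (+ 2 * m) + + 2 * m * - (q + 1ℤ) ≡ r - + 2 * m
    shift-down-more = solve-∀

  centred-remainder : ∀ b m .{{_ : ℕ.NonZero m}} → ∃ λ t → ∣ b + + 2 * + m * t ∣ ℕ.≤ m
  centred-remainder b m = choose (r ℕ.≤? m)
    where
    instance _ = ℕ.m*n≢0 2 m
    D = 2 ℕ.* m
    r = b %ℕ D
    q = b /ℕ D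
    b≡r+q*2m : b ≡ + r + q * (+ 2 * + m)
    b≡r+q*2m = trans (a≡a%ℕn+[a/ℕn]*n b D) (cong (λ D → + r + q * D) (pos-* 2 m))
    choose : Dec (r ℕ.≤ m) → ∃ λ t → ∣ b + + 2 * + m * t ∣ ℕ.≤ m
    choose (yes r≤m) = - q , subst (λ z → ∣ z ∣ ℕ.≤ m) (sym b-2mq≡r) r≤m
      where
      b-2mq≡r : b + + 2 * + m * - q ≡ + r
      b-2mq≡r = trans (cong (λ b → b + + 2 * + m * - q) b≡r+q*2m) (shift-down (+ r) q (+ m))
    choose (no r≰m) = - (q + 1ℤ) , subst (λ z → ∣ z ∣ ℕ.≤ m) (sym b-2m[q+1]≡r-D) ∣r-D∣≤m
      where
      b-2m[q+1]≡r-D : b + + 2 * + m * - (q + 1ℤ) ≡ + r - + D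
      b-2m[q+1]≡r-D = trans (cong (λ b → b + + 2 * + m * - (q + 1ℤ)) b≡r+q*2m)
                        (trans (shift-down-more (+ r) q (+ m)) (cong (λ D → + r - D) (sym (pos-* 2 m))))
      D≤r+m : D ℕ.≤ r ℕ.+ m
      D≤r+m = subst (ℕ._≤ r ℕ.+ m) (cong (m ℕ.+_) (sym (ℕ.+-identityʳ m))) (ℕ.+-monoˡ-≤ m (ℕ.<⇒≤ (ℕ.≰⇒> r≰m)))
      ∣r-D∣≤m : ∣ + r - + D ∣ ℕ.≤ m
      ∣r-D∣≤m = subst (ℕ._≤ m) (sym (trans (cong ∣_∣ (m-n≡m⊖n r D)) (∣⊖∣-≤ (ℕ.<⇒≤ (n%ℕd<d b D)))))
                  (ℕ.m≤n+o⇒m∸n≤o D r D≤r+m)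

  private
    4ac≡b²-8 : ∀ a b c → b * b - + 4 * a * c ≡ + 8 → + 4 * a * c ≡ b * b - + 8
    4ac≡b²-8 a b c disc = trans (y≡x-[x-y] (b * b) (+ 4 * a * c)) (cong (λ d → b * b - d) disc)
      where
      y≡x-[x-y] : ∀ x y → y ≡ x - (x - y)
      y≡x-[x-y] = solve-∀

    4α²≰α²+8 : ∀ α → 2 ℕ.≤ α → ¬ (4 ℕ.* α ℕ.* α ℕ.≤ α ℕ.* α ℕ.+ 8)
    4α²≰α²+8 α 2≤α 4α²≤α²+8 = ℕ.≤⇒≯ 12≤8 (ℕ.m≤m+n 9 3)
      where
      4α²≡α²+3α² : ∀ α → 4 ℕ.* α ℕ.* α ≡ α ℕ.* α ℕ.+ 3 ℕ.* (α ℕ.* α)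
      4α²≡α²+3α² = ℕ-Solver.solve-∀
      12≤8 : 12 ℕ.≤ 8
      12≤8 = ℕ.≤-trans (ℕ.*-monoʳ-≤ 3 (ℕ.*-mono-≤ 2≤α 2≤α))
               (ℕ.+-cancelˡ-≤ (α ℕ.* α) _ _ (subst (ℕ._≤ α ℕ.* α ℕ.+ 8) (4α²≡α²+3α² α) 4α²≤α²+8))

  reduced-bound : ∀ {a b c} → 2 ℕ.≤ ∣ a ∣ → ∣ b ∣ ℕ.≤ ∣ a ∣ → b * b - + 4 * a * c ≡ + 8 → ∣ c ∣ ℕ.< ∣ a ∣
  reduced-bound {a} {b} {c} 2≤∣a∣ ∣b∣≤∣a∣ disc with ∣ c ∣ ℕ.<? ∣ a ∣
  ... | yes ∣c∣<∣a∣ = ∣c∣<∣a∣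
  ... | no ∣c∣≮∣a∣ = contradiction (begin
    4 ℕ.* α ℕ.* α          ≤⟨ ℕ.*-monoʳ-≤ (4 ℕ.* α) (ℕ.≮⇒≥ ∣c∣≮∣a∣) ⟩
    4 ℕ.* α ℕ.* ∣ c ∣      ≡⟨ cong (ℕ._* ∣ c ∣) (∣i*j∣≡∣i∣*∣j∣ (+ 4) a) ⟨
    ∣ + 4 * a ∣ ℕ.* ∣ c ∣  ≡⟨ ∣i*j∣≡∣i∣*∣j∣ (+ 4 * a) c ⟨
    ∣ + 4 * a * c ∣        ≡⟨ cong ∣_∣ (4ac≡b²-8 a b c disc) ⟩
    ∣ b * b - + 8 ∣        ≤⟨ ∣i-j∣≤∣i∣+∣j∣ (b * b) (+ 8) ⟩
    ∣ b * b ∣ ℕ.+ 8        ≡⟨ cong (ℕ._+ 8) (∣i*j∣≡∣i∣*∣j∣ b b) ⟩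
    ∣ b ∣ ℕ.* ∣ b ∣ ℕ.+ 8  ≤⟨ ℕ.+-monoˡ-≤ 8 (ℕ.*-mono-≤ ∣b∣≤∣a∣ ∣b∣≤∣a∣) ⟩
    α ℕ.* α ℕ.+ 8          ∎) (4α²≰α²+8 α 2≤∣a∣)
    where
    α = ∣ a ∣
    open ℕ.≤-Reasoning

  private
    at-1,0 : ∀ a b c → a * 1ℤ * 1ℤ + b * 1ℤ * 0ℤ + c * 0ℤ * 0ℤ ≡ a
    at-1,0 = solve-∀

    negated : ∀ a b c x y → - (a * x * x + - b * x * y + - c * y * y) ≡ - a * x * x + b * x * y + c * y * y
    negated = solve-∀

    negated-discriminant : ∀ a b c → - b * - b - + 4 * a * - c ≡ b * b - + 4 * - a * c
    negated-discriminant = solve-∀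

    zero-leading-discriminant : ∀ b c → b * b - + 4 * 0ℤ * c ≡ b * b
    zero-leading-discriminant = solve-∀

    translated : ∀ a b c t x y →
      (c + b * t + a * t * t) * x * x + - (b + + 2 * a * t) * x * y + a * y * y ≡
      a * (y - t * x) * (y - t * x) + b * (y - t * x) * - x + c * - x * - x
    translated = solve-∀

    translated-discriminant : ∀ a b c t →
      - (b + + 2 * a * t) * - (b + + 2 * a * t) - + 4 * (c + b * t + a * t * t) * a ≡ b * b - + 4 * a * c
    translated-discriminant = solve-∀

    translated-middle : ∀ a b c t →
      (b + + 2 * a * t) * (b + + 2 * a * t) - + 4 * a * (c + b * t + a * t * t) ≡ b * b - + 4 * a * c
    translated-middle = solve-∀

  m*m≢8 : ∀ m → m ℕ.* m ≢ 8
  m*m≢8 0 ()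
  m*m≢8 1 ()
  m*m≢8 2 ()
  m*m≢8 (suc (suc (suc m))) eq = ℕ.≤⇒≯ (ℕ.≤-reflexive eq) (ℕ.*-mono-≤ (ℕ.m≤m+n 3 m) (ℕ.m≤m+n 3 m))

  -- Gauss reduction: a translation x ↦ x + t y makes |b| ≤ |a|, after which the swap (a, b, c) ↦ (c, -b, a)
  -- lowers |a| because the discriminant is only 8; at |a| = 1 the form represents a itself.
  private
    mutual
      represents-unit : ∀ n a b c → ∣ a ∣ ℕ.≤ n → b * b - + 4 * a * c ≡ + 8 → ∃₂ λ x y → IsUnit (form a b c x y)
      represents-unit n +0 b c _ disc =
        contradiction (+-injective (trans (+[∣i∣*∣i∣]≡i*i b) (trans (sym (zero-leading-discriminant b c)) disc))) (m*m≢8 ∣ b ∣)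
      represents-unit n +[1+ k ] b c ∣a∣≤n disc = positive-leading n k b c ∣a∣≤n disc
      represents-unit n -[1+ k ] b c ∣a∣≤n disc
        with positive-leading n k (- b) (- c) ∣a∣≤n (trans (negated-discriminant (+ suc k) b c) disc)
      ... | x , y , unit = x , y , subst IsUnit (negated (+ suc k) b c x y) (IsUnit-neg unit)

      positive-leading : ∀ n k b c → suc k ℕ.≤ n → b * b - + 4 * + suc k * c ≡ + 8 →
                         ∃₂ λ x y → IsUnit (form (+ suc k) b c x y)
      positive-leading n zero b c _ _ = 1ℤ , 0ℤ , inj₁ (at-1,0 1ℤ b c)
      positive-leading (suc n) (suc k) b c (s≤s 1+k<n) disc with centred-remainder b (suc (suc k))
      ... | t , ∣b′∣≤a = pull-back (represents-unit n c′ (- b′) a ∣c′∣≤n (trans (translated-discriminant a b c t) disc))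
        where
        a = + suc (suc k)
        b′ = b + + 2 * a * t
        c′ = c + b * t + a * t * t
        ∣c′∣≤n : ∣ c′ ∣ ℕ.≤ n
        ∣c′∣≤n = ℕ.≤-pred (ℕ.<-≤-trans (reduced-bound {a} {b′} {c′} (s≤s (s≤s z≤n)) ∣b′∣≤a (trans (translated-middle a b c t) disc))
            (s≤s 1+k<n))
        pull-back : (∃₂ λ x y → IsUnit (form c′ (- b′) a x y)) → ∃₂ λ x y → IsUnit (form a b c x y)
        pull-back (x , y , unit) = y - t * x , - x , subst IsUnit (translated a b c t x y) unit

  discriminant-8-represents-unit : ∀ a b c → b * b - + 4 * a * c ≡ + 8 → ∃₂ λ x y → IsUnit (form a b c x y)
  discriminant-8-represents-unit a b c = represents-unit ∣ a ∣ a b c ℕ.≤-refl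

module Parametrisations where

  open import Data.Nat.Base as ℕ using (ℕ)
  import Data.Nat.Properties as ℕ
  open import Data.Integer.Base hiding (suc)
  open import Data.Integer.Properties
  open import Data.Integer.Tactic.RingSolver using (solve-∀)
  open import Data.Product.Base using (∃₂; _,_)
  open import Data.Sum.Base using (inj₁; inj₂)
  open import Relation.Binary.PropositionalEquality using (_≡_; refl; sym; trans; cong; cong₂; subst; module ≡-Reasoning)

  open BinaryForms using (IsUnit; IsUnit-neg; form; discriminant-8-represents-unit)

  -- For α = a + b√2 and γ = l + m√2 one has α γ̄² = P a b l m - J a b l m √2 and N l m = γ γ̄.
  J : ℤ → ℤ → ℤ → ℤ → ℤ
  J a b l m = + 2 * a * l * m - b * (l * l + + 2 * (m * m))

  P : ℤ → ℤ → ℤ → ℤ → ℤ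
  P a b l m = a * (l * l + + 2 * (m * m)) - + 4 * b * l * m

  N : ℤ → ℤ → ℤ
  N l m = l * l - + 2 * (m * m)

  record Parametrisation (A x : ℕ) (a b l m : ℤ) : Set where
    field
      norm : + A ≡ N a b
      unit : IsUnit (J a b l m)
      size : ∣ P a b l m * N l m ∣ ≡ x
  open Parametrisation

  private
    ∣x*y∣-cong : ∀ x′ y′ x y → ∣ x′ ∣ ≡ ∣ x ∣ → ∣ y′ ∣ ≡ ∣ y ∣ → ∣ x′ * y′ ∣ ≡ ∣ x * y ∣
    ∣x*y∣-cong x′ y′ x y ∣x′∣≡∣x∣ ∣y′∣≡∣y∣ =
      trans (∣i*j∣≡∣i∣*∣j∣ x′ y′) (trans (cong₂ ℕ._*_ ∣x′∣≡∣x∣ ∣y′∣≡∣y∣) (sym (∣i*j∣≡∣i∣*∣j∣ x y)))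

    ∣-∣-neg : ∀ {x y} → x ≡ - y → ∣ x ∣ ≡ ∣ y ∣
    ∣-∣-neg {y = y} x≡-y = trans (cong ∣_∣ x≡-y) (∣-i∣≡∣i∣ y)

    N-neg : ∀ a b → - a * - a - + 2 * (- b * - b) ≡ a * a - + 2 * (b * b)
    N-neg = solve-∀
    N-conj : ∀ l m → l * l - + 2 * (- m * - m) ≡ l * l - + 2 * (m * m)
    N-conj = solve-∀
    N-flip : ∀ l m → - l * - l - + 2 * (m * m) ≡ l * l - + 2 * (m * m)
    N-flip = solve-∀
    J-conj : ∀ a b l m → + 2 * a * l * - m - - b * (l * l + + 2 * (- m * - m)) ≡ - (+ 2 * a * l * m - b * (l * l + + 2 * (m * m)))
    J-conj = solve-∀
    P-conj : ∀ a b l m → a * (l * l + + 2 * (- m * - m)) - + 4 * - b * l * - m ≡ a * (l * l + + 2 * (m * m)) - + 4 * b * l * m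
    P-conj = solve-∀
    J-flip : ∀ a b l m → + 2 * a * - l * m - - b * (- l * - l + + 2 * (m * m)) ≡ - (+ 2 * a * l * m - b * (l * l + + 2 * (m * m)))
    J-flip = solve-∀
    P-flip : ∀ a b l m → a * (- l * - l + + 2 * (m * m)) - + 4 * - b * - l * m ≡ a * (l * l + + 2 * (m * m)) - + 4 * b * l * m
    P-flip = solve-∀
    J-neg : ∀ a b l m → + 2 * - a * l * m - - b * (l * l + + 2 * (m * m)) ≡ - (+ 2 * a * l * m - b * (l * l + + 2 * (m * m)))
    J-neg = solve-∀
    P-neg : ∀ a b l m → - a * (l * l + + 2 * (m * m)) - + 4 * - b * l * m ≡ - (a * (l * l + + 2 * (m * m)) - + 4 * b * l * m)
    P-neg = solve-∀

    N-step : ∀ a b → (+ 3 * a + + 4 * b) * (+ 3 * a + + 4 * b) - + 2 * ((+ 2 * a + + 3 * b) * (+ 2 * a + + 3 * b)) ≡ a * a - + 2 * (b * b)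
    N-step = solve-∀
    N-step′ : ∀ l m → (l + + 2 * m) * (l + + 2 * m) - + 2 * ((l + m) * (l + m)) ≡ - (l * l - + 2 * (m * m))
    N-step′ = solve-∀
    J-step : ∀ a b l m → + 2 * (+ 3 * a + + 4 * b) * (l + + 2 * m) * (l + m)
        - (+ 2 * a + + 3 * b) * ((l + + 2 * m) * (l + + 2 * m) + + 2 * ((l + m) * (l + m)))
                       ≡ + 2 * a * l * m - b * (l * l + + 2 * (m * m))
    J-step = solve-∀
    P-step : ∀ a b l m → (+ 3 * a + + 4 * b) * ((l + + 2 * m) * (l + + 2 * m) + + 2 * ((l + m) * (l + m)))
        - + 4 * (+ 2 * a + + 3 * b) * (l + + 2 * m) * (l + m)
                       ≡ a * (l * l + + 2 * (m * m)) - + 4 * b * l * m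
    P-step = solve-∀

  conjugate : ∀ {A x a b l m} → Parametrisation A x a b l m → Parametrisation A x a (- b) l (- m)
  conjugate {a = a} {b} {l} {m} p = record
    { norm = trans (norm p) (sym (N-conj a b))
    ; unit = subst IsUnit (sym (J-conj a b l m)) (IsUnit-neg (unit p))
    ; size = trans (∣x*y∣-cong (P a (- b) l (- m)) (N l (- m)) (P a b l m) (N l m)
        (cong ∣_∣ (P-conj a b l m)) (cong ∣_∣ (N-conj l m))) (size p)
    }

  flip-l : ∀ {A x a b l m} → Parametrisation A x a b l m → Parametrisation A x a (- b) (- l) m
  flip-l {a = a} {b} {l} {m} p = record
    { norm = trans (norm p) (sym (N-conj a b))
    ; unit = subst IsUnit (sym (J-flip a b l m)) (IsUnit-neg (unit p))
    ; size = trans (∣x*y∣-cong (P a (- b) (- l) m) (N (- l) m) (P a b l m) (N l m)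
        (cong ∣_∣ (P-flip a b l m)) (cong ∣_∣ (N-flip l m))) (size p)
    }

  negate : ∀ {A x a b l m} → Parametrisation A x a b l m → Parametrisation A x (- a) (- b) l m
  negate {a = a} {b} {l} {m} p = record
    { norm = trans (norm p) (sym (N-neg a b))
    ; unit = subst IsUnit (sym (J-neg a b l m)) (IsUnit-neg (unit p))
    ; size = trans (∣x*y∣-cong (P (- a) (- b) l m) (N l m) (P a b l m) (N l m) (∣-∣-neg (P-neg a b l m)) refl) (size p)
    }

  -- Multiplies α by (1 + √2)² and γ by 1 + √2, which leaves α γ̄² unchanged.
  unit-step : ∀ {A x a b l m} → Parametrisation A x a b l m →
              Parametrisation A x (+ 3 * a + + 4 * b) (+ 2 * a + + 3 * b) (l + + 2 * m) (l + m)
  unit-step {a = a} {b} {l} {m} p = record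
    { norm = trans (norm p) (sym (N-step a b))
    ; unit = subst IsUnit (sym (J-step a b l m)) (unit p)
    ; size = trans (∣x*y∣-cong (P (+ 3 * a + + 4 * b) (+ 2 * a + + 3 * b) (l + + 2 * m) (l + m)) (N (l + + 2 * m) (l + m))
                               (P a b l m) (N l m) (cong ∣_∣ (P-step a b l m)) (∣-∣-neg (N-step′ l m))) (size p)
    }

  IsUnit-square : ∀ {q} → IsUnit q → q * q ≡ 1ℤ
  IsUnit-square (inj₁ refl) = refl
  IsUnit-square (inj₂ refl) = refl

  IsUnit-abs : ∀ {q} → IsUnit q → ∣ q ∣ ≡ 1
  IsUnit-abs (inj₁ refl) = refl
  IsUnit-abs (inj₂ refl) = refl

  private
    x+2-x-2≡0 : ∀ x → x + + 2 - x - + 2 ≡ 0ℤ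
    x+2-x-2≡0 = solve-∀

    discriminant-identity : ∀ U D A → - (+ 2 * U) * - (+ 2 * U) - + 4 * D * (A * D) ≡ + 4 * (U * U - A * (D * D) - + 2) + + 8
    discriminant-identity = solve-∀

    ≡-modulo : ∀ {h x y} c → h ≡ 0ℤ → x ≡ y + h * c → x ≡ y
    ≡-modulo {y = y} c refl x≡y+0 = trans x≡y+0 (+-identityʳ y)

    -- Let σ = u + √2, so σ σ̄ = A d², and let Q be the value of the form at (k, j). Then β = kσ - jAd satisfies
    -- β (kd - jσ) = Qσ, so α = β² / σ and γ̄ = kd - jσ give α γ̄² = Q²σ and N(γ) = dQ. Written out in
    -- coordinates these hold modulo h = u² - Ad² - 2, with the cofactor of h made explicit.
    norm-identity : ∀ U D A k j →
      let a = k * k * U - + 2 * k * j * A * D + j * j * A * U ; b = k * k - j * j * A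
          Q = D * k * k + - (+ 2 * U) * k * j + A * D * j * j ; h = U * U - A * (D * D) - + 2 in
      a * a - + 2 * (b * b) ≡ A * (Q * Q) + h * (b * b)
    norm-identity = solve-∀

    J-identity : ∀ U D A k j →
      let a = k * k * U - + 2 * k * j * A * D + j * j * A * U ; b = k * k - j * j * A ; l = k * D - j * U
          Q = D * k * k + - (+ 2 * U) * k * j + A * D * j * j ; h = U * U - A * (D * D) - + 2 in
      + 2 * a * l * j - b * (l * l + + 2 * (j * j)) ≡ - (Q * Q) + h * (j * j * b)
    J-identity = solve-∀

    P-identity : ∀ U D A k j →
      let a = k * k * U - + 2 * k * j * A * D + j * j * A * U ; b = k * k - j * j * A ; l = k * D - j * U
          Q = D * k * k + - (+ 2 * U) * k * j + A * D * j * j ; h = U * U - A * (D * D) - + 2 in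
      a * (l * l + + 2 * (j * j)) - + 4 * b * l * j ≡ U * (Q * Q)
          + h * (U * A * (j * j * (j * j)) - + 3 * U * (k * k) * (j * j) + + 2 * D * (k * k * k) * j)
    P-identity = solve-∀

    N-identity : ∀ U D A k j →
      let l = k * D - j * U ; Q = D * k * k + - (+ 2 * U) * k * j + A * D * j * j ; h = U * U - A * (D * D) - + 2 in
      l * l - + 2 * (j * j) ≡ D * Q + h * (j * j)
    N-identity = solve-∀

  u²≡Ad²+2⇒u²-Ad²-2≡0 : ∀ {A u d} → u ℕ.* u ≡ A ℕ.* (d ℕ.* d) ℕ.+ 2 → + u * + u - + A * (+ d * + d) - + 2 ≡ 0ℤ
  u²≡Ad²+2⇒u²-Ad²-2≡0 {A} {u} {d} u²≡Ad²+2 = trans (cong (λ s → s - + A * (+ d * + d) - + 2) u²≡Ad²+2′)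
    (x+2-x-2≡0 (+ A * (+ d * + d)))
    where
    open ≡-Reasoning
    u²≡Ad²+2′ : + u * + u ≡ + A * (+ d * + d) + + 2
    u²≡Ad²+2′ = begin
      + u * + u                      ≡⟨ pos-* u u ⟨
      + (u ℕ.* u)                    ≡⟨ cong +_ u²≡Ad²+2 ⟩
      + (A ℕ.* (d ℕ.* d) ℕ.+ 2)      ≡⟨ pos-+ (A ℕ.* (d ℕ.* d)) 2 ⟩
      + (A ℕ.* (d ℕ.* d)) + + 2      ≡⟨ cong (_+ + 2) (pos-* A (d ℕ.* d)) ⟩
      + A * + (d ℕ.* d) + + 2        ≡⟨ cong (λ dd → + A * dd + + 2) (pos-* d d) ⟩
      + A * (+ d * + d) + + 2        ∎

  from-unit-representation : ∀ {A u d k j} → u ℕ.* u ≡ A ℕ.* (d ℕ.* d) ℕ.+ 2 →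
    IsUnit (form (+ d) (- (+ 2 * + u)) (+ A * + d) k j) →
    ∃₂ λ a b → ∃₂ λ l m → Parametrisation A (u ℕ.* d) a b l m
  from-unit-representation {A} {u} {d} {k} {j} u²≡Ad²+2 unit-Q = a , b , l , j , record
    { norm = sym (trans (≡-modulo (b * b) h≡0 (norm-identity U D AA k j)) (trans (cong (AA *_) Q²≡1) (*-identityʳ AA)))
    ; unit = inj₂ (trans (≡-modulo (j * j * b) h≡0 (J-identity U D AA k j)) (cong -_ Q²≡1))
    ; size = begin
        ∣ P a b l j * N l j ∣          ≡⟨ cong₂ (λ p n → ∣ p * n ∣) P≡U N≡DQ ⟩
        ∣ U * (D * Q) ∣                ≡⟨ ∣i*j∣≡∣i∣*∣j∣ U (D * Q) ⟩
        u ℕ.* ∣ D * Q ∣                ≡⟨ cong (u ℕ.*_) (∣i*j∣≡∣i∣*∣j∣ D Q) ⟩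
        u ℕ.* (d ℕ.* ∣ Q ∣)            ≡⟨ cong (λ q → u ℕ.* (d ℕ.* q)) (IsUnit-abs unit-Q) ⟩
        u ℕ.* (d ℕ.* 1)                ≡⟨ cong (u ℕ.*_) (ℕ.*-identityʳ d) ⟩
        u ℕ.* d                        ∎
    }
    where
    open ≡-Reasoning
    U = + u
    D = + d
    AA = + A
    a = k * k * U - + 2 * k * j * AA * D + j * j * AA * U
    b = k * k - j * j * AA
    l = k * D - j * U
    Q = D * k * k + - (+ 2 * U) * k * j + AA * D * j * j
    h = U * U - AA * (D * D) - + 2
    h≡0 : h ≡ 0ℤ
    h≡0 = u²≡Ad²+2⇒u²-Ad²-2≡0 {A} {u} {d} u²≡Ad²+2
    Q²≡1 : Q * Q ≡ 1ℤ
    Q²≡1 = IsUnit-square unit-Q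
    P≡U : P a b l j ≡ U
    P≡U = trans (≡-modulo _ h≡0 (P-identity U D AA k j)) (trans (cong (U *_) Q²≡1) (*-identityʳ U))
    N≡DQ : N l j ≡ D * Q
    N≡DQ = ≡-modulo (j * j) h≡0 (N-identity U D AA k j)

  parametrisation : ∀ {A u d} → u ℕ.* u ≡ A ℕ.* (d ℕ.* d) ℕ.+ 2 →
    ∃₂ λ a b → ∃₂ λ l m → Parametrisation A (u ℕ.* d) a b l m
  parametrisation {A} {u} {d} u²≡Ad²+2 =
    let k , j , unit-Q = discriminant-8-represents-unit (+ d) (- (+ 2 * + u)) (+ A * + d) discriminant≡8
    in from-unit-representation {A} {u} {d} {k} {j} u²≡Ad²+2 unit-Q
    where
    discriminant≡8 : - (+ 2 * + u) * - (+ 2 * + u) - + 4 * + d * (+ A * + d) ≡ + 8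
    discriminant≡8 = trans (discriminant-identity (+ u) (+ d) (+ A))
      (cong (λ h → + 4 * h + + 8) (u²≡Ad²+2⇒u²-Ad²-2≡0 {A} {u} {d} u²≡Ad²+2))

module Normalisation where

  open import Data.Nat.Base as ℕ using (ℕ; suc; z≤n; s≤s)
  import Data.Nat.Properties as ℕ
  open import Data.Integer.Base hiding (suc)
  open import Data.Integer.Properties
  open import Data.Integer.Tactic.RingSolver using (solve-∀)
  open import Data.Product.Base using (∃₂; _×_; _,_)
  open import Relation.Binary.PropositionalEquality using (_≡_; refl; sym; trans; subst; subst₂)
  open import Relation.Nullary.Decidable using (Dec; yes; no)
  open import Relation.Nullary.Negation using (contradiction)

  open IntegerSquares using (0≤i*i; i*i<j*j⇒i<j)
  open Parametrisations

  private
    0<i-j⇒j<i : ∀ {i j} → 0ℤ < i - j → j < i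
    0<i-j⇒j<i {i} {j} 0<i-j = subst₂ _<_ (+-identityʳ j) (j+[i-j]≡i i j) (+-monoʳ-< j 0<i-j)
      where
      j+[i-j]≡i : ∀ i j → j + (i - j) ≡ i
      j+[i-j]≡i = solve-∀

    j<i⇒0<i-j : ∀ {i j} → j < i → 0ℤ < i - j
    j<i⇒0<i-j {i} {j} j<i = subst (_< i - j) (+-inverseʳ j) (+-monoˡ-< (- j) j<i)

    +∣i∣≡-i : ∀ {i} → i ≤ 0ℤ → + ∣ i ∣ ≡ - i
    +∣i∣≡-i {+0} _ = refl
    +∣i∣≡-i { -[1+ n ]} _ = refl
    +∣i∣≡-i {+[1+ n ]} (+≤+ ())

    0<j*j-i*i⇒i<j : ∀ {i j} → 0ℤ ≤ j → 0ℤ < j * j - i * i → i < j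
    0<j*j-i*i⇒i<j 0≤j 0<j²-i² = i*i<j*j⇒i<j 0≤j (0<i-j⇒j<i 0<j²-i²)

    [3a]²-[-4b]² : ∀ a b → + 3 * a * (+ 3 * a) - - (+ 4 * b) * - (+ 4 * b) ≡ + 9 * (a * a - + 2 * (b * b)) + + 2 * (b * b)
    [3a]²-[-4b]² = solve-∀

    a²-[-b]² : ∀ a b → a * a - - b * - b ≡ (a * a - + 2 * (b * b)) + b * b
    a²-[-b]² = solve-∀

    3a-[-4b] : ∀ a b → + 3 * a - - (+ 4 * b) ≡ + 3 * a + + 4 * b
    3a-[-4b] = solve-∀

    [-b]-[-[2a+3b]] : ∀ a b → - b - - (+ 2 * a + + 3 * b) ≡ + 2 * (a - - b)
    [-b]-[-[2a+3b]] = solve-∀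

    0<3a+4b : ∀ {a b} → 0ℤ < a → 0ℤ < N a b → 0ℤ < + 3 * a + + 4 * b
    0<3a+4b {a} {b} 0<a 0<N = subst (0ℤ <_) (3a-[-4b] a b) (j<i⇒0<i-j (0<j*j-i*i⇒i<j 0≤3a
      (subst (0ℤ <_) (sym ([3a]²-[-4b]² a b)) (+-mono-<-≤ (*-monoˡ-<-pos (+ 9) 0<N) (*-monoˡ-≤-nonNeg (+ 2) (0≤i*i b))))))
      where
      0≤3a : 0ℤ ≤ + 3 * a
      0≤3a = *-monoˡ-≤-nonNeg (+ 3) (<⇒≤ 0<a)

    -b<a : ∀ {a b} → 0ℤ < a → 0ℤ < N a b → - b < a
    -b<a {a} {b} 0<a 0<N = 0<j*j-i*i⇒i<j (<⇒≤ 0<a) (subst (0ℤ <_) (sym (a²-[-b]² a b)) (+-mono-<-≤ 0<N (0≤i*i b)))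

    ∣2a+3b∣<∣b∣ : ∀ {a b} → 0ℤ < a → 0ℤ < N a b → b ≤ 0ℤ → + 2 * a + + 3 * b ≤ 0ℤ → ∣ + 2 * a + + 3 * b ∣ ℕ.< ∣ b ∣
    ∣2a+3b∣<∣b∣ {a} {b} 0<a 0<N b≤0 b′≤0 = drop‿+<+ (subst₂ _<_ (sym (+∣i∣≡-i b′≤0)) (sym (+∣i∣≡-i b≤0))
      (0<i-j⇒j<i (subst (0ℤ <_) (sym ([-b]-[-[2a+3b]] a b)) (*-monoˡ-<-pos (+ 2) (j<i⇒0<i-j (-b<a 0<a 0<N))))))

  NormalParametrisation : ℕ → ℕ → Set
  NormalParametrisation A x = ∃₂ λ a b → ∃₂ λ l m → 0ℤ < a × 0ℤ < b × 0ℤ ≤ l × 0ℤ ≤ m × Parametrisation A x a b l m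

  -- A unit step keeps a > 0 and l, m ≥ 0; while b ≤ 0 it lowers |b|, since a > √2 |b|.
  make-b-positive : ∀ n {A x a b l m} → 0 ℕ.< A → ∣ b ∣ ℕ.< n → 0ℤ < a → 0ℤ ≤ l → 0ℤ ≤ m →
                    Parametrisation A x a b l m → NormalParametrisation A x
  make-b-positive (suc n) {A} {x} {a} {b} {l} {m} 0<A ∣b∣<1+n 0<a 0≤l 0≤m p = by-signs (0ℤ <? b) (0ℤ <? + 2 * a + + 3 * b)
    where
    0<N : 0ℤ < N a b
    0<N = subst (0ℤ <_) (Parametrisation.norm p) (+<+ 0<A)
    0≤l+2m : 0ℤ ≤ l + + 2 * m
    0≤l+2m = +-mono-≤ 0≤l (*-monoˡ-≤-nonNeg (+ 2) 0≤m)
    0≤l+m : 0ℤ ≤ l + m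
    0≤l+m = +-mono-≤ 0≤l 0≤m
    by-signs : Dec (0ℤ < b) → Dec (0ℤ < + 2 * a + + 3 * b) → NormalParametrisation A x
    by-signs (yes 0<b) _ = a , b , l , m , 0<a , 0<b , 0≤l , 0≤m , p
    by-signs (no 0≮b) (yes 0<b′) = _ , _ , _ , _ , 0<3a+4b 0<a 0<N , 0<b′ , 0≤l+2m , 0≤l+m , unit-step p
    by-signs (no 0≮b) (no 0≮b′) =
      make-b-positive n 0<A (ℕ.<-≤-trans (∣2a+3b∣<∣b∣ 0<a 0<N (≮⇒≥ 0≮b) (≮⇒≥ 0≮b′)) (ℕ.s≤s⁻¹ ∣b∣<1+n))
                      (0<3a+4b 0<a 0<N) 0≤l+2m 0≤l+m (unit-step p)

  nonneg-l : ∀ {A x a b} l {m} → Parametrisation A x a b l m → ∃₂ λ b′ l′ → 0ℤ ≤ l′ × Parametrisation A x a b′ l′ m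
  nonneg-l (+ n) p = _ , + n , +≤+ z≤n , p
  nonneg-l -[1+ n ] p = _ , _ , +≤+ z≤n , flip-l p

  nonneg-m : ∀ {A x a b l} m → Parametrisation A x a b l m → ∃₂ λ b′ m′ → 0ℤ ≤ m′ × Parametrisation A x a b′ l m′
  nonneg-m (+ n) p = _ , + n , +≤+ z≤n , p
  nonneg-m -[1+ n ] p = _ , _ , +≤+ z≤n , conjugate p

  positive-a : ∀ {A x b l m} a → 0 ℕ.< A → Parametrisation A x a b l m → ∃₂ λ a′ b′ → 0ℤ < a′ × Parametrisation A x a′ b′ l m
  positive-a {b = b} +0 0<A p = contradiction (trans (Parametrisation.norm p) (N0b≡-2b² b)) λ A≡-2b² → >⇒≰ (+<+ 0<A)
    (subst (_≤ 0ℤ) (sym A≡-2b²) (neg-mono-≤ (*-monoˡ-≤-nonNeg (+ 2) (0≤i*i b))))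
    where
    N0b≡-2b² : ∀ b → 0ℤ * 0ℤ - + 2 * (b * b) ≡ - (+ 2 * (b * b))
    N0b≡-2b² = solve-∀
  positive-a +[1+ n ] _ p = _ , _ , +<+ (s≤s z≤n) , p
  positive-a -[1+ n ] _ p = _ , _ , +<+ (s≤s z≤n) , negate p

  normalise : ∀ {A x a b l m} → 0 ℕ.< A → Parametrisation A x a b l m → NormalParametrisation A x
  normalise 0<A p with nonneg-l _ p
  ... | _ , _ , 0≤l , p₁ with nonneg-m _ p₁
  ... | _ , _ , 0≤m , p₂ with positive-a _ 0<A p₂
  ... | _ , b , 0<a , p₃ = make-b-positive (suc ∣ b ∣) 0<A ℕ.≤-refl 0<a 0≤l 0≤m p₃


open import Defs
open import Data.Nat using (ℕ; _%_)
open import Data.Nat.Primality using (Prime)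
open import Data.Integer using (ℤ; +_; -_; _+_; _-_; _*_; _>_; ∣_∣)
open import Data.Product using (Σ; _×_)
open import Data.Sum using (_⊎_)
open import Relation.Binary.PropositionalEquality using (_≡_)

open import Data.Nat.Primality using (prime⇒nonZero)
import Data.Nat.Base as ℕ
open import Data.Integer.Properties using (0≤i⇒+∣i∣≡i)
open import Data.Product using (_,_)
open import Relation.Binary.PropositionalEquality using (sym; trans; subst; subst₂)
open import Function.Base using (case_of_)

open MinimalSolution using (minimal-pell-solution)
open MinimalSolutionFactorisation using (minimal-solution-factorisation)
open Parametrisations using (Parametrisation; parametrisation)
open Normalisation using (normalise)

proposition7 : (A : ℕ) → Prime A → A % 8 ≡ 7 →
    Σ ℤ (λ a → Σ ℤ (λ b → Σ ℕ (λ l → Σ ℕ (λ m →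
      a > + 0 × b > + 0
      × + A ≡ a * a - + 2 * (b * b)
      × ((+ 2 * a * + l * + m - b * (+ l * + l + + 2 * (+ m * + m)) ≡ + 1)
         ⊎ (+ 2 * a * + l * + m - b * (+ l * + l + + 2 * (+ m * + m)) ≡ - + 1))
      × MinimalPellSolution A
          ∣ (a * (+ l * + l + + 2 * (+ m * + m)) - + 4 * b * + l * + m)
            * (+ l * + l - + 2 * (+ m * + m)) ∣))))
proposition7 A A-prime A%8≡7 =
  case minimal-pell-solution A-prime of λ where
    (x , minimal) → case minimal-solution-factorisation A-prime A%8≡7 minimal of λ where
      (u , d , u²≡Ad²+2 , x≡u*d) → case parametrisation {A} {u} {d} u²≡Ad²+2 of λ where
        (_ , _ , _ , _ , p) → case normalise 0<A p of λ where
          (a , b , l , m , 0<a , 0<b , 0≤l , 0≤m , p′) →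
            let p″ = subst₂ (Parametrisation A (u ℕ.* d) a b) (sym (0≤i⇒+∣i∣≡i 0≤l)) (sym (0≤i⇒+∣i∣≡i 0≤m)) p′
            in a , b , ∣ l ∣ , ∣ m ∣ , 0<a , 0<b , Parametrisation.norm p″ , Parametrisation.unit p″ ,
               subst (MinimalPellSolution A) (trans x≡u*d (sym (Parametrisation.size p″))) minimal
  where
  0<A : 0 ℕ.< A
  0<A = ℕ.>-nonZero⁻¹ A {{prime⇒nonZero A-prime}}
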